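{- Let $C^{\geq}(x;1,q;1)=\sum_{n\ge1}x^n\sum_{w}q^{\mathrm{area}(w)}$, the inner sum over all Catalan words $w$ of length $n$ avoiding the pattern $(\geq,\geq)$. Let $B(x,q)=\sum_{w\in\mathcal{B},\,w\ne\epsilon}x^{|w|}q^{\mathrm{area}(w)}$, where $\mathcal{B}$ is the set of Catalan words avoiding $(\geq,\geq)$ that do not end with two letters $ab$ with $a\ge b$. Then \[ C^{\geq}(x;1,q;1)= \sum_{i=1}^{\infty} x^i q^{\frac{i(i+1)}{2}} \prod_{j=0}^{i-1} \left(1+B\!\left(x q^j, q \right)\right). \]
   Context: A Catalan word of length $n\ge 0$ is a sequence $w=w_1\cdots w_n$ of non-negative integers with $w_1=0$ and $0\le w_i\le w_{i-1}+1$ for $i=2,\dots,n$; $|w|$ is its length and $\epsilon$ the empty word. It avoids the pattern $(\geq,\geq)$ if there is no index $i$ with $w_i\ge w_{i+1}\ge w_{i+2}$. $\mathrm{area}(w)=\sum_{i=1}^n(w_i+1)$. -}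

module Defs where

open import Data.Nat using (ℕ; zero; suc; _+_; _*_; _∸_; _/_; _≤ᵇ_; _≡ᵇ_)
open import Data.Bool using (Bool; true; false; _∧_; _∨_; not; if_then_else_)
open import Data.List using (List; []; _∷_; [_]; map; concatMap; upTo; length; filterᵇ)
open import Data.Nat.ListAction using (sum)

Word : Set
Word = List ℕ

stepOK : ℕ → Word → Bool
stepOK p [] = true
stepOK p (a ∷ w) = (a ≤ᵇ suc p) ∧ stepOK a w

isCatalan : Word → Bool
isCatalan [] = true
isCatalan (a ∷ w) = (a ≡ᵇ 0) ∧ stepOK a w

hasGeGe : Word → Bool
hasGeGe (a ∷ b ∷ c ∷ w) = ((b ≤ᵇ a) ∧ (c ≤ᵇ b)) ∨ hasGeGe (b ∷ c ∷ w)
hasGeGe _ = false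

endsGe : Word → Bool
endsGe [] = false
endsGe (a ∷ []) = false
endsGe (a ∷ b ∷ []) = b ≤ᵇ a
endsGe (a ∷ b ∷ c ∷ w) = endsGe (b ∷ c ∷ w)

area : Word → ℕ
area w = sum (map suc w)

allWords : ℕ → ℕ → List Word
allWords zero m = [ [] ]
allWords (suc n) m = concatMap (λ a → map (a ∷_) (allWords n m)) (upTo m)

-- Catalan words of length n (letters of a Catalan word of length n are < n)
catalanWords : ℕ → List Word
catalanWords n = filterᵇ isCatalan (allWords n n)

-- Formal power series in x, q with ℕ coefficients:
-- f n k is the coefficient of x^n q^k.

Series : Set
Series = ℕ → ℕ → ℕ

sumTo : ℕ → (ℕ → ℕ) → ℕ
sumTo zero f = 0
sumTo (suc n) f = sumTo n f + f n

_⊕_ : Series → Series → Series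
(f ⊕ g) n k = f n k + g n k

_⊗_ : Series → Series → Series
(f ⊗ g) n k = sumTo (suc n) (λ a → sumTo (suc k) (λ b → f a b * g (n ∸ a) (k ∸ b)))

mono : ℕ → ℕ → Series
mono i m n k = if (n ≡ᵇ i) ∧ (k ≡ᵇ m) then 1 else 0

𝟙 : Series
𝟙 = mono 0 0

-- substitution x ↦ x q^j :  f(x q^j, q)
substXq : ℕ → Series → Series
substXq j f n k = if (j * n) ≤ᵇ k then f n (k ∸ j * n) else 0

prodTo : ℕ → (ℕ → Series) → Series
prodTo zero F = 𝟙
prodTo (suc i) F = prodTo i F ⊗ F i

count : (Word → Bool) → List Word → ℕ
count p ws = length (filterᵇ p ws)

Cge : Series
Cge zero k = 0
Cge (suc n) k =
  count (λ w → not (hasGeGe w) ∧ (area w ≡ᵇ k)) (catalanWords (suc n))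

Bser : Series
Bser zero k = 0
Bser (suc n) k =
  count (λ w → not (hasGeGe w) ∧ not (endsGe w) ∧ (area w ≡ᵇ k)) (catalanWords (suc n))

summand : ℕ → Series
summand i = mono i ((i * suc i) / 2) ⊗ prodTo i (λ j → 𝟙 ⊕ substXq j Bser)

partialSum : ℕ → Series
partialSum M n k = sumTo M (λ i → summand (suc i) n k)

-- Let E_e be the generating function of the (≥,≥)-avoiding Catalan words ending in the letter e.
-- Such a word ending in e + 1 splits uniquely after the last occurrence of e as u · v: u avoids the
-- pattern and ends in e, and since steps go up by at most one, every letter of v exceeds e, so
-- v − (e + 1) is an avoiding word ending in 0; the junction is a strict ascent, so no occurrence of
-- the pattern crosses it.  An avoiding word ending in 0 is t · 0 with t empty or in 𝓑, and adding c to
-- every letter of a word of length n multiplies its weight by q^(cn).  Hence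
--   E_0 = (1 + B(x, q)) x q   and   E_(e+1) = E_e · (1 + B(x q^(e+1), q)) x q^(e+2),
-- so E_e is the (e+1)-st summand x^(e+1) q^((e+1)(e+2)/2) ∏_(j≤e) (1 + B(x q^j, q)).  Summing over
-- the last letter gives C^≥, and the i-th summand has no terms of x-degree below i, so the
-- coefficient of x^n q^k is reached by every partial sum with at least n summands.

{-# OPTIONS --safe #-}
module Submission where

open import Defs
open import Data.Nat using (ℕ; _≤_)
open import Data.Product using (∃-syntax)
open import Relation.Binary.PropositionalEquality using (_≡_)

open import Algebra.Properties.CommutativeSemigroup using (interchange)
open import Data.Bool using (Bool; true; false; T; _∧_; _∨_; not; if_then_else_)
open import Data.Bool.ListAction using (all; any)
open import Data.Bool.Properties
  using (∧-conicalˡ; ∧-conicalʳ; ∨-conicalˡ; ∨-conicalʳ; ∧-assoc; ∨-assoc; ∧-zeroʳ; ∧-identityʳ; ∨-identityʳ)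
open import Data.Empty using (⊥; ⊥-elim)
open import Data.List
  using (List; []; _∷_; _++_; [_]; map; concatMap; applyUpTo; upTo; length; filterᵇ; take; drop; null; initLast; _∷ʳ′_)
open import Data.List.Properties
  using (map-++; map-∘; map-cong; map-id; length-++; length-map; length-take; take++drop≡id; ++-identityʳ; ∷-injectiveʳ)
open import Data.List.Relation.Unary.All using (All; []; _∷_)
open import Data.List.Relation.Unary.All.Properties using (gmap⁺)
open import Data.Nat using (zero; suc; _+_; _*_; _∸_; _/_; _<_; _≰_; _≮_; _≤ᵇ_; _≡ᵇ_; s≤s; z<s; _≟_; _≤?_)
open import Data.Nat.DivMod using (+-distrib-/-∣ʳ; m*n/n≡m)
open import Data.Nat.Divisibility using (divides)
open import Data.Nat.ListAction using (sum)
open import Data.Nat.ListAction.Properties using (sum-++)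
open import Data.Nat.Properties
  using ( +-comm; +-assoc; +-suc; +-identityʳ; +-cancelʳ-≡; +-cancelˡ-≤; +-monoʳ-<; +-monoʳ-≤; +-monoˡ-≤
        ; *-comm; *-assoc; *-identityˡ; *-zeroʳ; *-distribˡ-+; *-distribʳ-+
        ; +-commutativeSemigroup; *-commutativeSemigroup
        ; ≤-refl; ≤-reflexive; ≤-trans; ≤-pred; <-irrefl; <-trans; <⇒≢; <⇒≱; ≮⇒≥; ≤∧≢⇒<; n<1+n; m<n⇒m<1+n
        ; m≤m+n; m≤n+m; m∸n≤m; m+n∸m≡n; m+[n∸m]≡n; m∸[m∸n]≡n; n∸n≡0; m≤n⇒m⊓n≡m
        ; suc-injective; 1+n≢n; ≤ᵇ⇒≤; ≤⇒≤ᵇ; ≡ᵇ⇒≡ )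
open import Data.Nat.Solver using (module +-*-Solver)
open import Data.Product using (_×_; _,_)
open import Function using (_∘_)
open import Level using (0ℓ)
open import Relation.Binary.Bundles using (Setoid)
open import Relation.Binary.PropositionalEquality using (_≢_; refl; sym; trans; cong; cong₂; subst; module ≡-Reasoning)
import Relation.Binary.Reasoning.Setoid as SetoidReasoning
open import Relation.Nullary using (¬_; yes; no; contradiction)

open +-*-Solver using (solve; _:*_; _:+_; _:=_; con)

⟦_⟧ : Bool → ℕ
⟦ true ⟧ = 1
⟦ false ⟧ = 0

⟦∧⟧ : ∀ a b → ⟦ a ∧ b ⟧ ≡ ⟦ a ⟧ * ⟦ b ⟧
⟦∧⟧ true b = sym (+-identityʳ ⟦ b ⟧)
⟦∧⟧ false b = refl

≤ᵇ-sound : ∀ {m n} → (m ≤ᵇ n) ≡ true → m ≤ n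
≤ᵇ-sound {m} {n} eq = ≤ᵇ⇒≤ m n (subst T (sym eq) _)

≤ᵇ-complete : ∀ {m n} → m ≤ n → (m ≤ᵇ n) ≡ true
≤ᵇ-complete {m} {n} m≤n with m ≤ᵇ n | ≤⇒≤ᵇ m≤n
... | true | _ = refl

≤ᵇ-false : ∀ {m n} → m ≰ n → (m ≤ᵇ n) ≡ false
≤ᵇ-false {m} {n} m≰n with m ≤ᵇ n in eq
... | true = contradiction (≤ᵇ-sound eq) m≰n
... | false = refl

≡ᵇ-sound : ∀ {m n} → (m ≡ᵇ n) ≡ true → m ≡ n
≡ᵇ-sound {m} {n} eq = ≡ᵇ⇒≡ m n (subst T (sym eq) _)

≡ᵇ-refl : ∀ n → (n ≡ᵇ n) ≡ true
≡ᵇ-refl zero = refl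
≡ᵇ-refl (suc n) = ≡ᵇ-refl n

≡ᵇ-false : ∀ {m n} → m ≢ n → (m ≡ᵇ n) ≡ false
≡ᵇ-false {m} {n} m≢n with m ≡ᵇ n in eq
... | true = contradiction (≡ᵇ-sound eq) m≢n
... | false = refl

≡ᵇ-sym : ∀ m n → (m ≡ᵇ n) ≡ (n ≡ᵇ m)
≡ᵇ-sym zero zero = refl
≡ᵇ-sym zero (suc n) = refl
≡ᵇ-sym (suc m) zero = refl
≡ᵇ-sym (suc m) (suc n) = ≡ᵇ-sym m n

+-≡ᵇ-cancelˡ : ∀ c m n → (c + m ≡ᵇ c + n) ≡ (m ≡ᵇ n)
+-≡ᵇ-cancelˡ zero m n = refl
+-≡ᵇ-cancelˡ (suc c) m n = +-≡ᵇ-cancelˡ c m n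

+-≤ᵇ-cancelˡ : ∀ c m n → (c + m ≤ᵇ c + n) ≡ (m ≤ᵇ n)
+-≤ᵇ-cancelˡ c m n with m ≤? n
... | yes m≤n = trans (≤ᵇ-complete (+-monoʳ-≤ c m≤n)) (sym (≤ᵇ-complete m≤n))
... | no m≰n = trans (≤ᵇ-false (m≰n ∘ +-cancelˡ-≤ c m n)) (sym (≤ᵇ-false m≰n))

≤ᵇ-∧-∸≡ᵇ0 : ∀ c y → (c ≤ᵇ y) ∧ (y ∸ c ≡ᵇ 0) ≡ (y ≡ᵇ c)
≤ᵇ-∧-∸≡ᵇ0 zero y = refl
≤ᵇ-∧-∸≡ᵇ0 (suc c) zero = refl
≤ᵇ-∧-∸≡ᵇ0 (suc zero) (suc y) = ≤ᵇ-∧-∸≡ᵇ0 zero y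
≤ᵇ-∧-∸≡ᵇ0 (suc (suc c)) (suc y) = ≤ᵇ-∧-∸≡ᵇ0 (suc c) y

sumTo-cong : ∀ n {f g : ℕ → ℕ} → (∀ i → i < n → f i ≡ g i) → sumTo n f ≡ sumTo n g
sumTo-cong zero eq = refl
sumTo-cong (suc n) eq = cong₂ _+_ (sumTo-cong n (λ i i<n → eq i (m<n⇒m<1+n i<n))) (eq n ≤-refl)

sumTo-zero : ∀ n {f : ℕ → ℕ} → (∀ i → i < n → f i ≡ 0) → sumTo n f ≡ 0
sumTo-zero n eq = trans (sumTo-cong n eq) (sumTo-0 n)
  where
  sumTo-0 : ∀ n → sumTo n (λ _ → 0) ≡ 0
  sumTo-0 zero = refl
  sumTo-0 (suc n) = trans (+-identityʳ _) (sumTo-0 n)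

sumTo-distrib-+ : ∀ n (f g : ℕ → ℕ) → sumTo n (λ i → f i + g i) ≡ sumTo n f + sumTo n g
sumTo-distrib-+ zero f g = refl
sumTo-distrib-+ (suc n) f g =
  trans (cong (_+ (f n + g n)) (sumTo-distrib-+ n f g))
        (interchange +-commutativeSemigroup (sumTo n f) (sumTo n g) (f n) (g n))

sumTo-*ˡ : ∀ n c (f : ℕ → ℕ) → sumTo n (λ i → c * f i) ≡ c * sumTo n f
sumTo-*ˡ zero c f = sym (*-zeroʳ c)
sumTo-*ˡ (suc n) c f = trans (cong (_+ c * f n) (sumTo-*ˡ n c f)) (sym (*-distribˡ-+ c (sumTo n f) (f n)))

sumTo-*ʳ : ∀ n c (f : ℕ → ℕ) → sumTo n (λ i → f i * c) ≡ sumTo n f * c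
sumTo-*ʳ zero c f = refl
sumTo-*ʳ (suc n) c f = trans (cong (_+ f n * c) (sumTo-*ʳ n c f)) (sym (*-distribʳ-+ c (sumTo n f) (f n)))

sumTo-swap : ∀ n m (f : ℕ → ℕ → ℕ) →
             sumTo n (λ i → sumTo m (f i)) ≡ sumTo m (λ j → sumTo n (λ i → f i j))
sumTo-swap zero m f = sym (sumTo-zero m (λ _ _ → refl))
sumTo-swap (suc n) m f =
  trans (cong (_+ sumTo m (f n)) (sumTo-swap n m f)) (sym (sumTo-distrib-+ m (λ j → sumTo n (λ i → f i j)) (f n)))

sumTo-single : ∀ n j (f : ℕ → ℕ) → j < n → (∀ i → i < n → i ≢ j → f i ≡ 0) → sumTo n f ≡ f j
sumTo-single (suc n) j f j<1+n vanish with j ≟ n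
... | yes refl = cong (_+ f j) (sumTo-zero j (λ i i<j → vanish i (m<n⇒m<1+n i<j) (<⇒≢ i<j)))
... | no j≢n = trans (cong₂ _+_ (sumTo-single n j f j<n (λ i i<n → vanish i (m<n⇒m<1+n i<n)))
                                (vanish n ≤-refl (j≢n ∘ sym)))
                     (+-identityʳ (f j))
  where
  j<n : j < n
  j<n = ≤∧≢⇒< (≤-pred j<1+n) j≢n

sumTo-sucˡ : ∀ n (f : ℕ → ℕ) → sumTo (suc n) f ≡ f 0 + sumTo n (f ∘ suc)
sumTo-sucˡ zero f = +-comm 0 (f 0)
sumTo-sucˡ (suc n) f = trans (cong (_+ f (suc n)) (sumTo-sucˡ n f)) (+-assoc (f 0) (sumTo n (f ∘ suc)) (f (suc n)))

sumTo-split : ∀ a b (f : ℕ → ℕ) → sumTo (a + b) f ≡ sumTo a f + sumTo b (λ i → f (a + i))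
sumTo-split a zero f = trans (cong (λ z → sumTo z f) (+-identityʳ a)) (sym (+-identityʳ _))
sumTo-split a (suc b) f = begin
  sumTo (a + suc b) f                                     ≡⟨ cong (λ z → sumTo z f) (+-suc a b) ⟩
  sumTo (a + b) f + f (a + b)                             ≡⟨ cong (_+ f (a + b)) (sumTo-split a b f) ⟩
  (sumTo a f + sumTo b (λ i → f (a + i))) + f (a + b)     ≡⟨ +-assoc (sumTo a f) _ _ ⟩
  sumTo a f + (sumTo b (λ i → f (a + i)) + f (a + b))     ∎
  where open ≡-Reasoning

sumTo-truncate : ∀ {m} L (f : ℕ → ℕ) → L ≤ m → (∀ i → L ≤ i → f i ≡ 0) → sumTo m f ≡ sumTo L f
sumTo-truncate {m} L f L≤m vanish = begin
  sumTo m f                                   ≡⟨ cong (λ z → sumTo z f) (sym (m+[n∸m]≡n L≤m)) ⟩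
  sumTo (L + (m ∸ L)) f                       ≡⟨ sumTo-split L (m ∸ L) f ⟩
  sumTo L f + sumTo (m ∸ L) (λ i → f (L + i)) ≡⟨ cong (sumTo L f +_) (sumTo-zero (m ∸ L) (λ i _ →
                                                   vanish (L + i) (m≤m+n L i))) ⟩
  sumTo L f + 0                               ≡⟨ +-identityʳ _ ⟩
  sumTo L f                                   ∎
  where open ≡-Reasoning

sumTo-reverse : ∀ n (f : ℕ → ℕ) → sumTo (suc n) f ≡ sumTo (suc n) (λ a → f (n ∸ a))
sumTo-reverse zero f = refl
sumTo-reverse (suc n) f = begin
  sumTo (suc n) f + f (suc n)                   ≡⟨ cong (_+ f (suc n)) (sumTo-reverse n f) ⟩
  sumTo (suc n) (λ a → f (n ∸ a)) + f (suc n)   ≡⟨ +-comm _ (f (suc n)) ⟩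
  f (suc n) + sumTo (suc n) (λ a → f (n ∸ a))   ≡⟨ sym (sumTo-sucˡ (suc n) (λ a → f (suc n ∸ a))) ⟩
  sumTo (suc (suc n)) (λ a → f (suc n ∸ a))     ∎
  where open ≡-Reasoning

-- Power series

-- shift₁ a u is x^a · u, and shift a b f is x^a q^b · f.

shift₁ : ℕ → (ℕ → ℕ) → ℕ → ℕ
shift₁ a u n = if a ≤ᵇ n then u (n ∸ a) else 0

shift : ℕ → ℕ → Series → Series
shift a b f n k = shift₁ a (λ n′ → shift₁ b (f n′) k) n

shift₁-suc : ∀ a u n → shift₁ (suc a) u (suc n) ≡ shift₁ a u n
shift₁-suc zero u n = refl
shift₁-suc (suc a) u n = refl

shift₁-cong : ∀ a {u v : ℕ → ℕ} n → (∀ m → u m ≡ v m) → shift₁ a u n ≡ shift₁ a v n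
shift₁-cong a n eq with a ≤ᵇ n
... | true = eq (n ∸ a)
... | false = refl

shift₁-shift₁ : ∀ a c u n → shift₁ a (shift₁ c u) n ≡ shift₁ (a + c) u n
shift₁-shift₁ zero c u n = refl
shift₁-shift₁ (suc a) c u zero = refl
shift₁-shift₁ (suc a) c u (suc n) =
  trans (shift₁-suc a (shift₁ c u) n) (trans (shift₁-shift₁ a c u n) (sym (shift₁-suc (a + c) u n)))

shift₁-comm : ∀ a b (h : ℕ → ℕ → ℕ) n k →
              shift₁ b (λ k′ → shift₁ a (λ n′ → h n′ k′) n) k
              ≡ shift₁ a (λ n′ → shift₁ b (h n′) k) n
shift₁-comm a b h n k with a ≤ᵇ n | b ≤ᵇ k
... | true | true = refl
... | true | false = refl
... | false | true = refl
... | false | false = refl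

shift₁-*ˡ : ∀ a c u n → c * shift₁ a u n ≡ shift₁ a (λ m → c * u m) n
shift₁-*ˡ a c u n with a ≤ᵇ n
... | true = refl
... | false = *-zeroʳ c

shift₁-*ʳ : ∀ a u c n → shift₁ a u n * c ≡ shift₁ a (λ m → u m * c) n
shift₁-*ʳ a u c n with a ≤ᵇ n
... | true = refl
... | false = refl

sumTo-shift₁-comm : ∀ N a (φ : ℕ → ℕ → ℕ) n →
                    sumTo N (λ j → shift₁ a (φ j) n) ≡ shift₁ a (λ m → sumTo N (λ j → φ j m)) n
sumTo-shift₁-comm N a φ n with a ≤ᵇ n
... | true = refl
... | false = sumTo-zero N (λ _ _ → refl)

sumTo-shift₁ : ∀ a n (G : ℕ → ℕ → ℕ) →
               sumTo (suc n) (λ i → shift₁ a (λ i′ → G i′ (n ∸ i)) i)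
               ≡ shift₁ a (λ m → sumTo (suc m) (λ i → G i (m ∸ i))) n
sumTo-shift₁ zero n G = refl
sumTo-shift₁ (suc a) zero G = refl
sumTo-shift₁ (suc a) (suc n) G = begin
  sumTo (suc (suc n)) (λ i → shift₁ (suc a) (λ i′ → G i′ (suc n ∸ i)) i)
    ≡⟨ sumTo-sucˡ (suc n) _ ⟩
  sumTo (suc n) (λ i → shift₁ (suc a) (λ i′ → G i′ (n ∸ i)) (suc i))
    ≡⟨ sumTo-cong (suc n) (λ i _ → shift₁-suc a (λ i′ → G i′ (n ∸ i)) i) ⟩
  sumTo (suc n) (λ i → shift₁ a (λ i′ → G i′ (n ∸ i)) i)
    ≡⟨ sumTo-shift₁ a n G ⟩
  shift₁ a (λ m → sumTo (suc m) (λ i → G i (m ∸ i))) n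
    ≡⟨ shift₁-suc a (λ m → sumTo (suc m) (λ i → G i (m ∸ i))) n ⟨
  shift₁ (suc a) (λ m → sumTo (suc m) (λ i → G i (m ∸ i))) (suc n) ∎
  where open ≡-Reasoning

sumTo-δ : ∀ a n (h : ℕ → ℕ) → sumTo (suc n) (λ i → ⟦ i ≡ᵇ a ⟧ * h (n ∸ i)) ≡ shift₁ a h n
sumTo-δ zero n h = begin
  sumTo (suc n) (λ i → ⟦ i ≡ᵇ 0 ⟧ * h (n ∸ i))             ≡⟨ sumTo-sucˡ n _ ⟩
  h n + 0 + sumTo n (λ i → ⟦ suc i ≡ᵇ 0 ⟧ * h (n ∸ suc i)) ≡⟨ cong (h n + 0 +_) (sumTo-zero n (λ _ _ → refl)) ⟩
  h n + 0 + 0                                             ≡⟨ trans (+-identityʳ _) (+-identityʳ _) ⟩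
  h n                                                     ∎
  where open ≡-Reasoning
sumTo-δ (suc a) zero h = refl
sumTo-δ (suc a) (suc n) h = trans (sumTo-sucˡ (suc n) _) (trans (sumTo-δ a n h) (sym (shift₁-suc a h n)))

⟦+≡ᵇ⟧ : ∀ x y k → ⟦ x + y ≡ᵇ k ⟧ ≡ shift₁ x (λ r → ⟦ y ≡ᵇ r ⟧) k
⟦+≡ᵇ⟧ x y k with x ≤? k
... | yes x≤k = begin
  ⟦ x + y ≡ᵇ k ⟧                ≡⟨ cong (λ k′ → ⟦ x + y ≡ᵇ k′ ⟧) (sym (m+[n∸m]≡n x≤k)) ⟩
  ⟦ x + y ≡ᵇ x + (k ∸ x) ⟧      ≡⟨ cong ⟦_⟧ (+-≡ᵇ-cancelˡ x y (k ∸ x)) ⟩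
  ⟦ y ≡ᵇ k ∸ x ⟧                ≡⟨ cong (λ b → if b then ⟦ y ≡ᵇ k ∸ x ⟧ else 0) (≤ᵇ-complete x≤k) ⟨
  shift₁ x (λ r → ⟦ y ≡ᵇ r ⟧) k ∎
  where open ≡-Reasoning
... | no x≰k = trans (cong ⟦_⟧ (≡ᵇ-false (λ x+y≡k → x≰k (≤-trans (m≤m+n x y) (≤-reflexive x+y≡k)))))
                     (cong (λ b → if b then ⟦ y ≡ᵇ k ∸ x ⟧ else 0) (sym (≤ᵇ-false x≰k)))

infix 4 _≈_
_≈_ : Series → Series → Set
f ≈ g = ∀ n k → f n k ≡ g n k

≈-setoid : Setoid 0ℓ 0ℓ
≈-setoid = record
  { Carrier = Series
  ; _≈_ = _≈_
  ; isEquivalence = record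
    { refl = λ n k → refl
    ; sym = λ f≈g n k → sym (f≈g n k)
    ; trans = λ f≈g g≈h n k → trans (f≈g n k) (g≈h n k)
    }
  }

⊗-coeff-cong : ∀ {f f′ g g′ : Series} n k →
               (∀ a b → a ≤ n → f a b ≡ f′ a b) → (∀ a b → a ≤ n → g a b ≡ g′ a b) →
               (f ⊗ g) n k ≡ (f′ ⊗ g′) n k
⊗-coeff-cong n k f≡f′ g≡g′ = sumTo-cong (suc n) (λ a a≤n → sumTo-cong (suc k) (λ b _ →
  cong₂ _*_ (f≡f′ a b (≤-pred a≤n)) (g≡g′ (n ∸ a) (k ∸ b) (m∸n≤m n a))))

⊗-cong : ∀ {f f′ g g′ : Series} → f ≈ f′ → g ≈ g′ → f ⊗ g ≈ f′ ⊗ g′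
⊗-cong f≈f′ g≈g′ n k = ⊗-coeff-cong n k (λ a b _ → f≈f′ a b) (λ a b _ → g≈g′ a b)

⊗-congˡ : ∀ {f f′} g → f ≈ f′ → f ⊗ g ≈ f′ ⊗ g
⊗-congˡ g f≈f′ = ⊗-cong {g = g} f≈f′ (λ _ _ → refl)

⊗-congʳ : ∀ f {g g′} → g ≈ g′ → f ⊗ g ≈ f ⊗ g′
⊗-congʳ f g≈g′ = ⊗-cong {f = f} (λ _ _ → refl) g≈g′

⊗-comm : ∀ f g → f ⊗ g ≈ g ⊗ f
⊗-comm f g n k = begin
  sumTo (suc n) (λ a → sumTo (suc k) (λ b → f a b * g (n ∸ a) (k ∸ b)))
    ≡⟨ sumTo-reverse n _ ⟩
  sumTo (suc n) (λ a → sumTo (suc k) (λ b → f (n ∸ a) b * g (n ∸ (n ∸ a)) (k ∸ b)))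
    ≡⟨ sumTo-cong (suc n) (λ a _ → sumTo-reverse k _) ⟩
  sumTo (suc n) (λ a → sumTo (suc k) (λ b → f (n ∸ a) (k ∸ b) * g (n ∸ (n ∸ a)) (k ∸ (k ∸ b))))
    ≡⟨ sumTo-cong (suc n) (λ a a≤n → sumTo-cong (suc k) (λ b b≤k →
         trans (*-comm (f (n ∸ a) (k ∸ b)) _)
               (cong₂ (λ x y → g x y * f (n ∸ a) (k ∸ b))
                      (m∸[m∸n]≡n (≤-pred a≤n)) (m∸[m∸n]≡n (≤-pred b≤k))))) ⟩
  sumTo (suc n) (λ a → sumTo (suc k) (λ b → g a b * f (n ∸ a) (k ∸ b))) ∎
  where open ≡-Reasoning

shift-cong : ∀ a b {f g} → f ≈ g → shift a b f ≈ shift a b g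
shift-cong a b f≈g n k = shift₁-cong a n (λ n′ → shift₁-cong b k (λ k′ → f≈g n′ k′))

mono-⊗ : ∀ a b f → mono a b ⊗ f ≈ shift a b f
mono-⊗ a b f n k = begin
  sumTo (suc n) (λ i → sumTo (suc k) (λ j → mono a b i j * f (n ∸ i) (k ∸ j)))
    ≡⟨ sumTo-cong (suc n) (λ i _ → trans (sumTo-cong (suc k) (λ j _ → mono-* i j _))
                                         (sumTo-*ˡ (suc k) ⟦ i ≡ᵇ a ⟧ _)) ⟩
  sumTo (suc n) (λ i → ⟦ i ≡ᵇ a ⟧ * sumTo (suc k) (λ j → ⟦ j ≡ᵇ b ⟧ * f (n ∸ i) (k ∸ j)))
    ≡⟨ sumTo-cong (suc n) (λ i _ → cong (⟦ i ≡ᵇ a ⟧ *_) (sumTo-δ b k (f (n ∸ i)))) ⟩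
  sumTo (suc n) (λ i → ⟦ i ≡ᵇ a ⟧ * shift₁ b (f (n ∸ i)) k)
    ≡⟨ sumTo-δ a n (λ n′ → shift₁ b (f n′) k) ⟩
  shift a b f n k ∎
  where
  open ≡-Reasoning
  mono-* : ∀ i j x → mono a b i j * x ≡ ⟦ i ≡ᵇ a ⟧ * (⟦ j ≡ᵇ b ⟧ * x)
  mono-* i j x with i ≡ᵇ a | j ≡ᵇ b
  ... | true | true = cong (1 *_) (sym (*-identityˡ x))
  ... | true | false = refl
  ... | false | _ = refl

𝟙-⊗ : ∀ f → 𝟙 ⊗ f ≈ f
𝟙-⊗ = mono-⊗ 0 0

shift-⊗ : ∀ a b f g → shift a b f ⊗ g ≈ shift a b (f ⊗ g)
shift-⊗ a b f g n k = begin
  sumTo (suc n) (λ i → sumTo (suc k) (λ j → shift₁ a (λ i′ → shift₁ b (f i′) j) i * g (n ∸ i) (k ∸ j)))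
    ≡⟨ sumTo-cong (suc n) (λ i _ → pull-out-x i) ⟩
  sumTo (suc n) (λ i → shift₁ a (λ i′ → G i′ (n ∸ i)) i)
    ≡⟨ sumTo-shift₁ a n G ⟩
  shift₁ a (λ m → sumTo (suc m) (λ i → G i (m ∸ i))) n
    ≡⟨ shift₁-cong a n (λ m → sumTo-cong (suc m) (λ i _ → pull-out-q m i)) ⟩
  shift₁ a (λ m → sumTo (suc m) (λ i → shift₁ b (H m i) k)) n
    ≡⟨ shift₁-cong a n (λ m → sumTo-shift₁-comm (suc m) b (H m) k) ⟩
  shift a b (f ⊗ g) n k ∎
  where
  open ≡-Reasoning
  G : ℕ → ℕ → ℕ
  G i m = sumTo (suc k) (λ j → shift₁ b (f i) j * g m (k ∸ j))
  H : ℕ → ℕ → ℕ → ℕ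
  H m i l = sumTo (suc l) (λ j → f i j * g (m ∸ i) (l ∸ j))
  pull-out-x : ∀ i → sumTo (suc k) (λ j → shift₁ a (λ i′ → shift₁ b (f i′) j) i * g (n ∸ i) (k ∸ j))
                     ≡ shift₁ a (λ i′ → G i′ (n ∸ i)) i
  pull-out-x i = trans (sumTo-cong (suc k) (λ j _ → shift₁-*ʳ a (λ i′ → shift₁ b (f i′) j) (g (n ∸ i) (k ∸ j)) i))
                       (sumTo-shift₁-comm (suc k) a (λ j i′ → shift₁ b (f i′) j * g (n ∸ i) (k ∸ j)) i)
  pull-out-q : ∀ m i → G i (m ∸ i) ≡ shift₁ b (H m i) k
  pull-out-q m i = trans (sumTo-cong (suc k) (λ j _ → shift₁-*ʳ b (f i) (g (m ∸ i) (k ∸ j)) j))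
                         (sumTo-shift₁ b k (λ j l → f i j * g (m ∸ i) l))

⊗-shift : ∀ a b f g → f ⊗ shift a b g ≈ shift a b (f ⊗ g)
⊗-shift a b f g = begin
  f ⊗ shift a b g   ≈⟨ ⊗-comm f (shift a b g) ⟩
  shift a b g ⊗ f   ≈⟨ shift-⊗ a b g f ⟩
  shift a b (g ⊗ f) ≈⟨ shift-cong a b (⊗-comm g f) ⟩
  shift a b (f ⊗ g) ∎
  where open SetoidReasoning ≈-setoid

shift-shift : ∀ a b c d f → shift a b (shift c d f) ≈ shift (a + c) (b + d) f
shift-shift a b c d f n k = begin
  shift₁ a (λ n′ → shift₁ b (λ k′ → shift₁ c (λ n″ → shift₁ d (f n″) k′) n′) k) n
    ≡⟨ shift₁-cong a n (λ n′ → shift₁-comm c b (λ n″ → shift₁ d (f n″)) n′ k) ⟩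
  shift₁ a (shift₁ c (λ n″ → shift₁ b (shift₁ d (f n″)) k)) n
    ≡⟨ shift₁-shift₁ a c (λ n″ → shift₁ b (shift₁ d (f n″)) k) n ⟩
  shift₁ (a + c) (λ n″ → shift₁ b (shift₁ d (f n″)) k) n
    ≡⟨ shift₁-cong (a + c) n (λ n″ → shift₁-shift₁ b d (f n″) k) ⟩
  shift (a + c) (b + d) f n k ∎
  where open ≡-Reasoning

factor : ℕ → Series
factor j = 𝟙 ⊕ substXq j Bser

triangle : ℕ → ℕ
triangle i = (i * suc i) / 2

triangle-suc : ∀ i → triangle (suc i) ≡ triangle i + suc i
triangle-suc i = begin
  (suc i * suc (suc i)) / 2          ≡⟨ cong (_/ 2) (expand i) ⟩
  (i * suc i + suc i * 2) / 2        ≡⟨ +-distrib-/-∣ʳ (i * suc i) (divides (suc i) refl) ⟩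
  (i * suc i) / 2 + (suc i * 2) / 2  ≡⟨ cong (triangle i +_) (m*n/n≡m (suc i) 2) ⟩
  triangle i + suc i                 ∎
  where
  open ≡-Reasoning
  expand : ∀ i → suc i * suc (suc i) ≡ i * suc i + suc i * 2
  expand = solve 1 (λ i → (con 1 :+ i) :* (con 2 :+ i) := i :* (con 1 :+ i) :+ (con 1 :+ i) :* con 2) refl

summand-zero : summand 0 ≈ 𝟙
summand-zero = mono-⊗ 0 0 𝟙

summand-suc : ∀ i → summand (suc i) ≈ summand i ⊗ (factor i ⊗ mono 1 (suc i))
summand-suc i = begin
  mono (suc i) (triangle (suc i)) ⊗ (P ⊗ F)  ≈⟨ mono-⊗ (suc i) (triangle (suc i)) (P ⊗ F) ⟩
  shift (suc i) (triangle (suc i)) (P ⊗ F)   ≈⟨ (λ n k → cong₂ (λ a b → shift a b (P ⊗ F) n k)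
                                                              (+-comm 1 i) (triangle-suc i)) ⟩
  shift (i + 1) (triangle i + suc i) (P ⊗ F) ≈⟨ shift-shift i (triangle i) 1 (suc i) (P ⊗ F) ⟨
  shift i (triangle i) (shift 1 (suc i) (P ⊗ F)) ≈⟨ shift-cong i (triangle i) (⊗-shift 1 (suc i) P F) ⟨
  shift i (triangle i) (P ⊗ shift 1 (suc i) F)   ≈⟨ shift-⊗ i (triangle i) P (shift 1 (suc i) F) ⟨
  shift i (triangle i) P ⊗ shift 1 (suc i) F     ≈⟨ ⊗-cong (mono-⊗ i (triangle i) P) (mono-⊗ 1 (suc i) F) ⟨
  summand i ⊗ (mono 1 (suc i) ⊗ F)               ≈⟨ ⊗-congʳ (summand i) (⊗-comm (mono 1 (suc i)) F) ⟩
  summand i ⊗ (F ⊗ mono 1 (suc i))               ∎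
  where
  open SetoidReasoning ≈-setoid
  P = prodTo i factor
  F = factor i

summand-vanishes : ∀ i {n} k → n < i → summand i n k ≡ 0
summand-vanishes i {n} k n<i = trans (mono-⊗ i (triangle i) (prodTo i factor) n k)
  (cong (λ b → if b then shift₁ (triangle i) (prodTo i factor (n ∸ i)) k else 0) (≤ᵇ-false (<⇒≱ n<i)))

sumWords : ℕ → ℕ → (Word → ℕ) → ℕ
sumWords zero m f = f []
sumWords (suc n) m f = sumTo m (λ x → sumWords n m (λ w → f (x ∷ w)))

sum-map-applyUpTo : ∀ n (g h : ℕ → ℕ) → sum (map h (applyUpTo g n)) ≡ sumTo n (h ∘ g)
sum-map-applyUpTo zero g h = refl
sum-map-applyUpTo (suc n) g h =
  trans (cong (h (g 0) +_) (sum-map-applyUpTo n (g ∘ suc) h)) (sym (sumTo-sucˡ n (h ∘ g)))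

sum-map-concatMap : ∀ (f : Word → ℕ) (g : ℕ → List Word) xs →
                    sum (map f (concatMap g xs)) ≡ sum (map (λ x → sum (map f (g x))) xs)
sum-map-concatMap f g [] = refl
sum-map-concatMap f g (x ∷ xs) = begin
  sum (map f (g x ++ concatMap g xs))               ≡⟨ cong sum (map-++ f (g x) (concatMap g xs)) ⟩
  sum (map f (g x) ++ map f (concatMap g xs))       ≡⟨ sum-++ (map f (g x)) _ ⟩
  sum (map f (g x)) + sum (map f (concatMap g xs))  ≡⟨ cong (sum (map f (g x)) +_) (sum-map-concatMap f g xs) ⟩
  sum (map f (g x)) + sum (map (λ x → sum (map f (g x))) xs) ∎
  where open ≡-Reasoning

sum-map-allWords : ∀ n m (f : Word → ℕ) → sum (map f (allWords n m)) ≡ sumWords n m f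
sum-map-allWords zero m f = +-identityʳ (f [])
sum-map-allWords (suc n) m f = begin
  sum (map f (concatMap (λ x → map (x ∷_) (allWords n m)) (upTo m)))
    ≡⟨ sum-map-concatMap f _ (upTo m) ⟩
  sum (map (λ x → sum (map f (map (x ∷_) (allWords n m)))) (upTo m))
    ≡⟨ cong sum (map-cong (λ x → cong sum (sym (map-∘ (allWords n m)))) (upTo m)) ⟩
  sum (map (λ x → sum (map (λ w → f (x ∷ w)) (allWords n m))) (upTo m))
    ≡⟨ cong sum (map-cong (λ x → sum-map-allWords n m (λ w → f (x ∷ w))) (upTo m)) ⟩
  sum (map (λ x → sumWords n m (λ w → f (x ∷ w))) (upTo m))
    ≡⟨ sum-map-applyUpTo m (λ x → x) _ ⟩
  sumWords (suc n) m f ∎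
  where open ≡-Reasoning

count-filterᵇ : ∀ p q (ws : List Word) → count p (filterᵇ q ws) ≡ sum (map (λ w → ⟦ q w ∧ p w ⟧) ws)
count-filterᵇ p q [] = refl
count-filterᵇ p q (w ∷ ws) with q w
... | false = count-filterᵇ p q ws
... | true with p w
...   | true = cong suc (count-filterᵇ p q ws)
...   | false = count-filterᵇ p q ws

count-catalanWords : ∀ n p → count p (catalanWords n) ≡ sumWords n n (λ w → ⟦ isCatalan w ∧ p w ⟧)
count-catalanWords n p = trans (count-filterᵇ p isCatalan (allWords n n)) (sum-map-allWords n n _)

sumWords-cong : ∀ n m {f g : Word → ℕ} → (∀ w → length w ≡ n → f w ≡ g w) → sumWords n m f ≡ sumWords n m g
sumWords-cong zero m eq = eq [] refl
sumWords-cong (suc n) m eq = sumTo-cong m (λ x _ → sumWords-cong n m (λ w ∣w∣≡n → eq (x ∷ w) (cong suc ∣w∣≡n)))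

sumWords-zero : ∀ n m {f : Word → ℕ} → (∀ w → length w ≡ n → f w ≡ 0) → sumWords n m f ≡ 0
sumWords-zero zero m eq = eq [] refl
sumWords-zero (suc n) m eq = sumTo-zero m (λ x _ → sumWords-zero n m (λ w ∣w∣≡n → eq (x ∷ w) (cong suc ∣w∣≡n)))

sumWords-distrib-+ : ∀ n m (f g : Word → ℕ) → sumWords n m (λ w → f w + g w) ≡ sumWords n m f + sumWords n m g
sumWords-distrib-+ zero m f g = refl
sumWords-distrib-+ (suc n) m f g =
  trans (sumTo-cong m (λ x _ → sumWords-distrib-+ n m (f ∘ (x ∷_)) (g ∘ (x ∷_)))) (sumTo-distrib-+ m _ _)

sumWords-*ˡ : ∀ n m c (f : Word → ℕ) → sumWords n m (λ w → c * f w) ≡ c * sumWords n m f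
sumWords-*ˡ zero m c f = refl
sumWords-*ˡ (suc n) m c f = trans (sumTo-cong m (λ x _ → sumWords-*ˡ n m c (f ∘ (x ∷_)))) (sumTo-*ˡ m c _)

sumWords-*ʳ : ∀ n m c (f : Word → ℕ) → sumWords n m (λ w → f w * c) ≡ sumWords n m f * c
sumWords-*ʳ zero m c f = refl
sumWords-*ʳ (suc n) m c f = trans (sumTo-cong m (λ x _ → sumWords-*ʳ n m c (f ∘ (x ∷_)))) (sumTo-*ʳ m c _)

sumWords-sumTo : ∀ n m N (f : ℕ → Word → ℕ) →
                 sumWords n m (λ w → sumTo N (λ i → f i w)) ≡ sumTo N (λ i → sumWords n m (f i))
sumWords-sumTo zero m N f = refl
sumWords-sumTo (suc n) m N f =
  trans (sumTo-cong m (λ x _ → sumWords-sumTo n m N (λ i w → f i (x ∷ w))))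
        (sumTo-swap m N (λ x i → sumWords n m (λ w → f i (x ∷ w))))

sumWords-shift₁ : ∀ n m s (φ : Word → ℕ → ℕ) k →
                  sumWords n m (λ w → shift₁ s (φ w) k) ≡ shift₁ s (λ r → sumWords n m (λ w → φ w r)) k
sumWords-shift₁ n m s φ k with s ≤ᵇ k
... | true = refl
... | false = sumWords-zero n m (λ _ _ → refl)

sumWords-++ : ∀ a n m (f : Word → ℕ) → a ≤ n →
              sumWords n m f ≡ sumWords a m (λ u → sumWords (n ∸ a) m (λ v → f (u ++ v)))
sumWords-++ zero n m f _ = refl
sumWords-++ (suc a) (suc n) m f (s≤s a≤n) = sumTo-cong m (λ x _ → sumWords-++ a n m (f ∘ (x ∷_)) a≤n)

sumWords-alphabet : ∀ n {L m} (f : Word → ℕ) → L ≤ m → (∀ w → length w ≡ n → ¬ All (_< L) w → f w ≡ 0) →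
                    sumWords n m f ≡ sumWords n L f
sumWords-alphabet zero f L≤m vanish = refl
sumWords-alphabet (suc n) {L} f L≤m vanish = trans
  (sumTo-truncate L _ L≤m (λ x L≤x → sumWords-zero n _ (λ w ∣w∣≡n →
     vanish (x ∷ w) (cong suc ∣w∣≡n) (λ { (x<L ∷ _) → <⇒≱ x<L L≤x }))))
  (sumTo-cong L (λ x x<L → sumWords-alphabet n (f ∘ (x ∷_)) L≤m (λ w ∣w∣≡n ¬all →
     vanish (x ∷ w) (cong suc ∣w∣≡n) (λ { (_ ∷ all) → ¬all all }))))

raise lower : ℕ → Word → Word
raise c = map (c +_)
lower c = map (_∸ c)

sumWords-raise : ∀ n c m (f : Word → ℕ) →
                 sumWords n (c + m) (λ v → ⟦ all (c ≤ᵇ_) v ⟧ * f v) ≡ sumWords n m (f ∘ raise c)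
sumWords-raise zero c m f = +-identityʳ (f [])
sumWords-raise (suc n) c m f = begin
  sumTo (c + m) (λ x → sumWords n (c + m) (λ v → ⟦ (c ≤ᵇ x) ∧ all (c ≤ᵇ_) v ⟧ * f (x ∷ v)))
    ≡⟨ sumTo-split c m _ ⟩
  sumTo c (λ x → sumWords n (c + m) (λ v → ⟦ (c ≤ᵇ x) ∧ all (c ≤ᵇ_) v ⟧ * f (x ∷ v))) +
  sumTo m (λ i → sumWords n (c + m) (λ v → ⟦ (c ≤ᵇ c + i) ∧ all (c ≤ᵇ_) v ⟧ * f (c + i ∷ v)))
    ≡⟨ cong₂ _+_ (sumTo-zero c below) (sumTo-cong m above) ⟩
  0 + sumTo m (λ i → sumWords n m (λ t → f (c + i ∷ raise c t))) ∎
  where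
  open ≡-Reasoning
  below : ∀ x → x < c → sumWords n (c + m) (λ v → ⟦ (c ≤ᵇ x) ∧ all (c ≤ᵇ_) v ⟧ * f (x ∷ v)) ≡ 0
  below x x<c = sumWords-zero n (c + m) (λ v _ →
                  cong (λ b → ⟦ b ∧ all (c ≤ᵇ_) v ⟧ * f (x ∷ v)) (≤ᵇ-false (<⇒≱ x<c)))
  above : ∀ i → i < m → sumWords n (c + m) (λ v → ⟦ (c ≤ᵇ c + i) ∧ all (c ≤ᵇ_) v ⟧ * f (c + i ∷ v))
                        ≡ sumWords n m (λ t → f (c + i ∷ raise c t))
  above i _ = trans (sumWords-cong n (c + m) (λ v _ →
                      cong (λ b → ⟦ b ∧ all (c ≤ᵇ_) v ⟧ * f (c + i ∷ v)) (≤ᵇ-complete (m≤m+n c i))))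
                    (sumWords-raise n c m (f ∘ (c + i ∷_)))

genFun : (Word → Bool) → ℕ → Series
genFun R m n k = sumWords n m (λ w → ⟦ R w ⟧ * ⟦ area w ≡ᵇ k ⟧)

record Factorisation (R P Q : Word → Bool) : Set where
  field
    split  : ∀ w → R w ≡ true → ∃[ u ] ∃[ v ] w ≡ u ++ v × P u ≡ true × Q v ≡ true
    join   : ∀ u v → P u ≡ true → Q v ≡ true → R (u ++ v) ≡ true
    unique : ∀ u v u′ v′ → u ++ v ≡ u′ ++ v′ → P u ≡ true → Q v ≡ true → P u′ ≡ true → Q v′ ≡ true →
             length u ≡ length u′

take-length-++ : ∀ (u v : Word) → take (length u) (u ++ v) ≡ u
take-length-++ [] v = refl
take-length-++ (x ∷ u) v = cong (x ∷_) (take-length-++ u v)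

drop-length-++ : ∀ (u v : Word) → drop (length u) (u ++ v) ≡ v
drop-length-++ [] v = refl
drop-length-++ (x ∷ u) v = drop-length-++ u v

⟦⟧-factorisation : ∀ {R P Q} → Factorisation R P Q → ∀ w →
                   ⟦ R w ⟧ ≡ sumTo (suc (length w)) (λ a → ⟦ P (take a w) ⟧ * ⟦ Q (drop a w) ⟧)
⟦⟧-factorisation {R} {P} {Q} fact w with R w in Rw
... | false = sym (sumTo-zero (suc (length w)) (λ a _ → no-split a))
  where
  open Factorisation fact
  no-split : ∀ a → ⟦ P (take a w) ⟧ * ⟦ Q (drop a w) ⟧ ≡ 0
  no-split a with P (take a w) in Pu | Q (drop a w) in Qv
  ... | true | true =
    contradiction (trans (sym (subst (λ z → R z ≡ true) (take++drop≡id a w) (join _ _ Pu Qv))) Rw) λ ()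
  ... | true | false = refl
  ... | false | _ = refl
... | true with Factorisation.split fact w Rw
...   | u , v , refl , Pu , Qv = sym (begin
  sumTo (suc (length (u ++ v))) (λ a → ⟦ P (take a (u ++ v)) ⟧ * ⟦ Q (drop a (u ++ v)) ⟧)
    ≡⟨ sumTo-single _ (length u) _ (s≤s (≤-trans (m≤m+n _ _) (≤-reflexive (sym (length-++ u))))) other-split ⟩
  ⟦ P (take (length u) (u ++ v)) ⟧ * ⟦ Q (drop (length u) (u ++ v)) ⟧
    ≡⟨ cong₂ (λ u′ v′ → ⟦ P u′ ⟧ * ⟦ Q v′ ⟧) (take-length-++ u v) (drop-length-++ u v) ⟩
  ⟦ P u ⟧ * ⟦ Q v ⟧
    ≡⟨ cong₂ (λ p q → ⟦ p ⟧ * ⟦ q ⟧) Pu Qv ⟩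
  1 ∎)
  where
  open ≡-Reasoning
  open Factorisation fact
  other-split : ∀ a → a < suc (length (u ++ v)) → a ≢ length u →
                ⟦ P (take a (u ++ v)) ⟧ * ⟦ Q (drop a (u ++ v)) ⟧ ≡ 0
  other-split a a≤∣w∣ a≢∣u∣ with P (take a (u ++ v)) in Pu′ | Q (drop a (u ++ v)) in Qv′
  ... | true | true = contradiction
          (trans (sym (trans (length-take a (u ++ v)) (m≤n⇒m⊓n≡m (≤-pred a≤∣w∣))))
                 (unique _ _ u v (take++drop≡id a (u ++ v)) Pu′ Qv′ Pu Qv))
          a≢∣u∣
  ... | true | false = refl
  ... | false | _ = refl

area-++ : ∀ u v → area (u ++ v) ≡ area u + area v
area-++ u v = trans (cong sum (map-++ suc u v)) (sum-++ (map suc u) (map suc v))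

⟦area-++≡ᵇ⟧ : ∀ u v k → ⟦ area (u ++ v) ≡ᵇ k ⟧ ≡ sumTo (suc k) (λ b → ⟦ area u ≡ᵇ b ⟧ * ⟦ area v ≡ᵇ k ∸ b ⟧)
⟦area-++≡ᵇ⟧ u v k = begin
  ⟦ area (u ++ v) ≡ᵇ k ⟧
    ≡⟨ cong (λ x → ⟦ x ≡ᵇ k ⟧) (area-++ u v) ⟩
  ⟦ area u + area v ≡ᵇ k ⟧
    ≡⟨ ⟦+≡ᵇ⟧ (area u) (area v) k ⟩
  shift₁ (area u) (λ r → ⟦ area v ≡ᵇ r ⟧) k
    ≡⟨ sumTo-δ (area u) k (λ r → ⟦ area v ≡ᵇ r ⟧) ⟨
  sumTo (suc k) (λ b → ⟦ b ≡ᵇ area u ⟧ * ⟦ area v ≡ᵇ k ∸ b ⟧)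
    ≡⟨ sumTo-cong (suc k) (λ b _ → cong (λ x → ⟦ x ⟧ * ⟦ area v ≡ᵇ k ∸ b ⟧) (≡ᵇ-sym b (area u))) ⟩
  sumTo (suc k) (λ b → ⟦ area u ≡ᵇ b ⟧ * ⟦ area v ≡ᵇ k ∸ b ⟧) ∎
  where open ≡-Reasoning

genFun-splitAt : ∀ P Q m {n} a k → a ≤ n →
                 sumWords n m (λ w → ⟦ P (take a w) ⟧ * ⟦ Q (drop a w) ⟧ * ⟦ area w ≡ᵇ k ⟧)
                 ≡ sumTo (suc k) (λ b → genFun P m a b * genFun Q m (n ∸ a) (k ∸ b))
genFun-splitAt P Q m {n} a k a≤n = begin
  sumWords n m (λ w → ⟦ P (take a w) ⟧ * ⟦ Q (drop a w) ⟧ * ⟦ area w ≡ᵇ k ⟧)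
    ≡⟨ sumWords-++ a n m _ a≤n ⟩
  sumWords a m (λ u → sumWords (n ∸ a) m (λ v →
    ⟦ P (take a (u ++ v)) ⟧ * ⟦ Q (drop a (u ++ v)) ⟧ * ⟦ area (u ++ v) ≡ᵇ k ⟧))
    ≡⟨ sumWords-cong a m (λ u ∣u∣≡a → sumWords-cong (n ∸ a) m (λ v _ → split-pointwise u v ∣u∣≡a)) ⟩
  sumWords a m (λ u → sumWords (n ∸ a) m (λ v → sumTo (suc k) (λ b → PArea u b * QArea v (k ∸ b))))
    ≡⟨ sumWords-cong a m (λ u _ → sumWords-sumTo (n ∸ a) m (suc k) _) ⟩
  sumWords a m (λ u → sumTo (suc k) (λ b → sumWords (n ∸ a) m (λ v → PArea u b * QArea v (k ∸ b))))
    ≡⟨ sumWords-sumTo a m (suc k) _ ⟩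
  sumTo (suc k) (λ b → sumWords a m (λ u → sumWords (n ∸ a) m (λ v → PArea u b * QArea v (k ∸ b))))
    ≡⟨ sumTo-cong (suc k) (λ b _ →
         trans (sumWords-cong a m (λ u _ → sumWords-*ˡ (n ∸ a) m (PArea u b) (λ v → QArea v (k ∸ b))))
               (sumWords-*ʳ a m (genFun Q m (n ∸ a) (k ∸ b)) (λ u → PArea u b))) ⟩
  sumTo (suc k) (λ b → genFun P m a b * genFun Q m (n ∸ a) (k ∸ b)) ∎
  where
  open ≡-Reasoning
  PArea QArea : Word → ℕ → ℕ
  PArea u b = ⟦ P u ⟧ * ⟦ area u ≡ᵇ b ⟧
  QArea v b = ⟦ Q v ⟧ * ⟦ area v ≡ᵇ b ⟧
  split-pointwise : ∀ u v → length u ≡ a →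
                    ⟦ P (take a (u ++ v)) ⟧ * ⟦ Q (drop a (u ++ v)) ⟧ * ⟦ area (u ++ v) ≡ᵇ k ⟧
                    ≡ sumTo (suc k) (λ b → PArea u b * QArea v (k ∸ b))
  split-pointwise u v refl = begin
    ⟦ P (take (length u) (u ++ v)) ⟧ * ⟦ Q (drop (length u) (u ++ v)) ⟧ * ⟦ area (u ++ v) ≡ᵇ k ⟧
      ≡⟨ cong₂ (λ u′ v′ → ⟦ P u′ ⟧ * ⟦ Q v′ ⟧ * ⟦ area (u ++ v) ≡ᵇ k ⟧) (take-length-++ u v) (drop-length-++ u v) ⟩
    ⟦ P u ⟧ * ⟦ Q v ⟧ * ⟦ area (u ++ v) ≡ᵇ k ⟧
      ≡⟨ cong (⟦ P u ⟧ * ⟦ Q v ⟧ *_) (⟦area-++≡ᵇ⟧ u v k) ⟩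
    ⟦ P u ⟧ * ⟦ Q v ⟧ * sumTo (suc k) (λ b → ⟦ area u ≡ᵇ b ⟧ * ⟦ area v ≡ᵇ k ∸ b ⟧)
      ≡⟨ sumTo-*ˡ (suc k) (⟦ P u ⟧ * ⟦ Q v ⟧) _ ⟨
    sumTo (suc k) (λ b → ⟦ P u ⟧ * ⟦ Q v ⟧ * (⟦ area u ≡ᵇ b ⟧ * ⟦ area v ≡ᵇ k ∸ b ⟧))
      ≡⟨ sumTo-cong (suc k) (λ b _ → interchange *-commutativeSemigroup ⟦ P u ⟧ ⟦ Q v ⟧ _ _) ⟩
    sumTo (suc k) (λ b → PArea u b * QArea v (k ∸ b)) ∎

genFun-⊗ : ∀ {R P Q} → Factorisation R P Q → ∀ m → genFun R m ≈ genFun P m ⊗ genFun Q m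
genFun-⊗ {R} {P} {Q} fact m n k = begin
  sumWords n m (λ w → ⟦ R w ⟧ * ⟦ area w ≡ᵇ k ⟧)
    ≡⟨ sumWords-cong n m over-split-points ⟩
  sumWords n m (λ w → sumTo (suc n) (λ a → ⟦ P (take a w) ⟧ * ⟦ Q (drop a w) ⟧ * ⟦ area w ≡ᵇ k ⟧))
    ≡⟨ sumWords-sumTo n m (suc n) _ ⟩
  sumTo (suc n) (λ a → sumWords n m (λ w → ⟦ P (take a w) ⟧ * ⟦ Q (drop a w) ⟧ * ⟦ area w ≡ᵇ k ⟧))
    ≡⟨ sumTo-cong (suc n) (λ a a<1+n → genFun-splitAt P Q m a k (≤-pred a<1+n)) ⟩
  (genFun P m ⊗ genFun Q m) n k ∎
  where
  open ≡-Reasoning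
  over-split-points : ∀ w → length w ≡ n → ⟦ R w ⟧ * ⟦ area w ≡ᵇ k ⟧
                      ≡ sumTo (suc n) (λ a → ⟦ P (take a w) ⟧ * ⟦ Q (drop a w) ⟧ * ⟦ area w ≡ᵇ k ⟧)
  over-split-points w refl = trans (cong (_* ⟦ area w ≡ᵇ k ⟧) (⟦⟧-factorisation fact w))
                                   (sym (sumTo-*ʳ (suc (length w)) ⟦ area w ≡ᵇ k ⟧ _))

Bounded : (ℕ → ℕ) → (Word → Bool) → Set
Bounded b R = ∀ w → R w ≡ true → All (_< b (length w)) w

genFun-alphabet : ∀ {b R} → Bounded b R → ∀ {m} n k → b n ≤ m → genFun R m n k ≡ genFun R (b n) n k
genFun-alphabet {b} {R} bounded n k bn≤m = sumWords-alphabet n _ bn≤m vanish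
  where
  vanish : ∀ w → length w ≡ n → ¬ All (_< b n) w → ⟦ R w ⟧ * ⟦ area w ≡ᵇ k ⟧ ≡ 0
  vanish w refl ¬bounded with R w in Rw
  ... | true = contradiction (bounded w Rw) ¬bounded
  ... | false = refl

lastOr : ℕ → Word → ℕ
lastOr x [] = x
lastOr x (y ∷ w) = lastOr y w

lastIs : ℕ → Word → Bool
lastIs e [] = false
lastIs e (x ∷ w) = lastOr x w ≡ᵇ e

avoids : Word → Bool
avoids w = isCatalan w ∧ not (hasGeGe w)

avoidsEndingIn : ℕ → Word → Bool
avoidsEndingIn e w = avoids w ∧ lastIs e w

raisedZeroEnding : ℕ → Word → Bool
raisedZeroEnding c v = all (c ≤ᵇ_) v ∧ avoidsEndingIn 0 (lower c v)

inB⁺ : Word → Bool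
inB⁺ [] = false
inB⁺ w@(_ ∷ _) = avoids w ∧ not (endsGe w)

raisedB⁺ : ℕ → Word → Bool
raisedB⁺ c u = all (c ≤ᵇ_) u ∧ inB⁺ (lower c u)

emptyOrRaisedB : ℕ → Word → Bool
emptyOrRaisedB c u = null u ∨ raisedB⁺ c u

isLetter : ℕ → Word → Bool
isLetter c (x ∷ []) = x ≡ᵇ c
isLetter c _ = false

lower-raise : ∀ c t → lower c (raise c t) ≡ t
lower-raise c [] = refl
lower-raise c (x ∷ t) = cong₂ _∷_ (m+n∸m≡n c x) (lower-raise c t)

raise-lower : ∀ c v → all (c ≤ᵇ_) v ≡ true → raise c (lower c v) ≡ v
raise-lower c [] _ = refl
raise-lower c (x ∷ v) all≥c =
  cong₂ _∷_ (m+[n∸m]≡n (≤ᵇ-sound {c} (∧-conicalˡ (c ≤ᵇ x) _ all≥c))) (raise-lower c v (∧-conicalʳ _ _ all≥c))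

all-raise : ∀ c t → all (c ≤ᵇ_) (raise c t) ≡ true
all-raise c [] = refl
all-raise c (x ∷ t) = cong₂ _∧_ (≤ᵇ-complete (m≤m+n c x)) (all-raise c t)

all-++ : ∀ (p : ℕ → Bool) u v → all p (u ++ v) ≡ all p u ∧ all p v
all-++ p [] v = refl
all-++ p (x ∷ u) v = trans (cong (p x ∧_) (all-++ p u v)) (sym (∧-assoc (p x) _ _))

stepOK-raise : ∀ c p t → stepOK (c + p) (raise c t) ≡ stepOK p t
stepOK-raise c p [] = refl
stepOK-raise c p (x ∷ t) =
  cong₂ _∧_ (trans (cong (c + x ≤ᵇ_) (sym (+-suc c p))) (+-≤ᵇ-cancelˡ c x (suc p))) (stepOK-raise c x t)

stepOK-raise-suc : ∀ e t → stepOK e (raise (suc e) t) ≡ isCatalan t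
stepOK-raise-suc e [] = refl
stepOK-raise-suc e (x ∷ t) = cong₂ _∧_ first (stepOK-raise (suc e) x t)
  where
  ≤ᵇ0≡≡ᵇ0 : ∀ x → (x ≤ᵇ 0) ≡ (x ≡ᵇ 0)
  ≤ᵇ0≡≡ᵇ0 zero = refl
  ≤ᵇ0≡≡ᵇ0 (suc x) = refl
  first : (suc e + x ≤ᵇ suc e) ≡ (x ≡ᵇ 0)
  first = trans (cong (suc e + x ≤ᵇ_) (sym (+-identityʳ (suc e)))) (trans (+-≤ᵇ-cancelˡ (suc e) x 0) (≤ᵇ0≡≡ᵇ0 x))

hasGeGe-raise : ∀ c t → hasGeGe (raise c t) ≡ hasGeGe t
hasGeGe-raise c (a ∷ b ∷ d ∷ t) =
  cong₂ _∨_ (cong₂ _∧_ (+-≤ᵇ-cancelˡ c b a) (+-≤ᵇ-cancelˡ c d b)) (hasGeGe-raise c (b ∷ d ∷ t))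
hasGeGe-raise c [] = refl
hasGeGe-raise c (_ ∷ []) = refl
hasGeGe-raise c (_ ∷ _ ∷ []) = refl

lastIs-raise : ∀ c e t → lastIs (c + e) (raise c t) ≡ lastIs e t
lastIs-raise c e [] = refl
lastIs-raise c e (x ∷ []) = +-≡ᵇ-cancelˡ c x e
lastIs-raise c e (x ∷ y ∷ t) = lastIs-raise c e (y ∷ t)

area-raise : ∀ c u → area (raise c u) ≡ c * length u + area u
area-raise c [] = sym (trans (+-identityʳ (c * 0)) (*-zeroʳ c))
area-raise c (x ∷ u) = begin
  suc (c + x) + area (raise c u)        ≡⟨ cong (suc (c + x) +_) (area-raise c u) ⟩
  suc (c + x) + (c * length u + area u) ≡⟨ rearrange c x (length u) (area u) ⟩
  c * suc (length u) + (suc x + area u) ∎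
  where
  open ≡-Reasoning
  rearrange : ∀ c x l A → suc (c + x) + (c * l + A) ≡ c * suc l + (suc x + A)
  rearrange = solve 4 (λ c x l A → con 1 :+ (c :+ x) :+ (c :* l :+ A) := c :* (con 1 :+ l) :+ (con 1 :+ x :+ A)) refl

lastOr-++ : ∀ x u y v → lastOr x (u ++ y ∷ v) ≡ lastOr y v
lastOr-++ x [] y v = refl
lastOr-++ x (z ∷ u) y v = lastOr-++ z u y v

lastIs-++ : ∀ e u y v → lastIs e (u ++ y ∷ v) ≡ lastIs e (y ∷ v)
lastIs-++ e [] y v = refl
lastIs-++ e (x ∷ u) y v = cong (_≡ᵇ e) (lastOr-++ x u y v)

stepOK-++ : ∀ p u v → stepOK p (u ++ v) ≡ stepOK p u ∧ stepOK (lastOr p u) v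
stepOK-++ p [] v = refl
stepOK-++ p (x ∷ u) v = trans (cong ((x ≤ᵇ suc p) ∧_) (stepOK-++ x u v)) (sym (∧-assoc (x ≤ᵇ suc p) _ _))

isCatalan-++ : ∀ x u v → isCatalan (x ∷ u ++ v) ≡ isCatalan (x ∷ u) ∧ stepOK (lastOr x u) v
isCatalan-++ x u v = trans (cong ((x ≡ᵇ 0) ∧_) (stepOK-++ x u v)) (sym (∧-assoc (x ≡ᵇ 0) _ _))

hasGeGe-++-ascent : ∀ x u y v → lastOr x u < y → hasGeGe (x ∷ u ++ y ∷ v) ≡ hasGeGe (x ∷ u) ∨ hasGeGe (y ∷ v)
hasGeGe-++-ascent x [] y [] x<y = refl
hasGeGe-++-ascent x [] y (z ∷ v) x<y rewrite ≤ᵇ-false (<⇒≱ x<y) = refl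
hasGeGe-++-ascent x (x′ ∷ []) y v x′<y rewrite ≤ᵇ-false (<⇒≱ x′<y) | ∧-zeroʳ (x′ ≤ᵇ x) =
  hasGeGe-++-ascent x′ [] y v x′<y
hasGeGe-++-ascent x (x′ ∷ x″ ∷ u) y v last<y =
  trans (cong (((x′ ≤ᵇ x) ∧ (x″ ≤ᵇ x′)) ∨_) (hasGeGe-++-ascent x′ (x″ ∷ u) y v last<y))
        (sym (∨-assoc ((x′ ≤ᵇ x) ∧ (x″ ≤ᵇ x′)) (hasGeGe (x′ ∷ x″ ∷ u)) (hasGeGe (y ∷ v))))

avoidsEndingIn⇒isCatalan : ∀ e w → avoidsEndingIn e w ≡ true → isCatalan w ≡ true
avoidsEndingIn⇒isCatalan e w Ew = ∧-conicalˡ _ _ (∧-conicalˡ _ (lastIs e w) Ew)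

avoidsEndingIn⇒lastIs : ∀ e w → avoidsEndingIn e w ≡ true → lastIs e w ≡ true
avoidsEndingIn⇒lastIs e w Ew = ∧-conicalʳ (avoids w) _ Ew

avoidsEndingIn-++-raise : ∀ e x u t₀ t → lastOr x u ≡ e →
  avoidsEndingIn (suc e) (x ∷ u ++ raise (suc e) (t₀ ∷ t)) ≡ avoids (x ∷ u) ∧ avoidsEndingIn 0 (t₀ ∷ t)
avoidsEndingIn-++-raise e x u t₀ t refl = trans
  (cong₂ _∧_ (cong₂ (λ a h → a ∧ not h) catalan pattern-free) last)
  (rearrange (isCatalan (x ∷ u)) (isCatalan (t₀ ∷ t)) (hasGeGe (x ∷ u)) (hasGeGe (t₀ ∷ t)) (lastIs 0 (t₀ ∷ t)))
  where
  r = raise (suc e) (t₀ ∷ t)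
  catalan : isCatalan (x ∷ u ++ r) ≡ isCatalan (x ∷ u) ∧ isCatalan (t₀ ∷ t)
  catalan = trans (isCatalan-++ x u r) (cong (isCatalan (x ∷ u) ∧_) (stepOK-raise-suc e (t₀ ∷ t)))
  pattern-free : hasGeGe (x ∷ u ++ r) ≡ hasGeGe (x ∷ u) ∨ hasGeGe (t₀ ∷ t)
  pattern-free = trans (hasGeGe-++-ascent x u (suc e + t₀) (raise (suc e) t) (s≤s (m≤m+n e t₀)))
                       (cong (hasGeGe (x ∷ u) ∨_) (hasGeGe-raise (suc e) (t₀ ∷ t)))
  last : lastIs (suc e) (x ∷ u ++ r) ≡ lastIs 0 (t₀ ∷ t)
  last = trans (lastIs-++ (suc e) (x ∷ u) (suc e + t₀) (raise (suc e) t))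
               (trans (cong (λ e′ → lastIs e′ r) (sym (+-identityʳ (suc e)))) (lastIs-raise (suc e) 0 (t₀ ∷ t)))
  rearrange : ∀ a b c d l → ((a ∧ b) ∧ not (c ∨ d)) ∧ l ≡ (a ∧ not c) ∧ ((b ∧ not d) ∧ l)
  rearrange true b false d l = refl
  rearrange true false true d l = refl
  rearrange true true true d l = refl
  rearrange false b c d l = refl

raisedZeroEnding-raise : ∀ c t → raisedZeroEnding c (raise c t) ≡ avoidsEndingIn 0 t
raisedZeroEnding-raise c t = cong₂ _∧_ (all-raise c t) (cong (avoidsEndingIn 0) (lower-raise c t))

-- Splitting an avoiding word after the last occurrence of e

occurs-between : ∀ {e y} p t → stepOK p t ≡ true → p < e → lastIs y (p ∷ t) ≡ true → e < y →
                 any (_≡ᵇ e) t ≡ true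
occurs-between {e} {y} p [] _ p<e p≡y e<y = contradiction (<-trans p<e e<y) (<-irrefl (≡ᵇ-sound p≡y))
occurs-between {e} p (x ∷ t) steps p<e last e<y with x ≟ e
... | yes refl = cong (_∨ any (_≡ᵇ x) t) (≡ᵇ-refl x)
... | no x≢e = trans (cong (_∨ any (_≡ᵇ e) t) (≡ᵇ-false x≢e))
                     (occurs-between x t (∧-conicalʳ (x ≤ᵇ suc p) _ steps) x<e last e<y)
  where
  x<e : x < e
  x<e = ≤∧≢⇒< (≤-trans (≤ᵇ-sound {x} (∧-conicalˡ _ (stepOK x t) steps)) p<e) x≢e

above-after-last : ∀ {e y} x t → stepOK x t ≡ true → any (_≡ᵇ e) (x ∷ t) ≡ false → lastIs y (x ∷ t) ≡ true →
                   e < y → all (suc e ≤ᵇ_) (x ∷ t) ≡ true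
above-after-last {e} x t steps e∉ last e<y = cong₂ _∧_ (≤ᵇ-complete e<x) (rest t steps e∉t last)
  where
  e∉t : any (_≡ᵇ e) t ≡ false
  e∉t = ∨-conicalʳ (x ≡ᵇ e) _ e∉
  x≢e : x ≢ e
  x≢e refl = contradiction (trans (sym (≡ᵇ-refl x)) (∨-conicalˡ (x ≡ᵇ x) _ e∉)) λ ()
  x≮e : x ≮ e
  x≮e x<e = contradiction (trans (sym (occurs-between x t steps x<e last e<y)) e∉t) λ ()
  e<x : e < x
  e<x = ≤∧≢⇒< (≮⇒≥ x≮e) (x≢e ∘ sym)
  rest : ∀ t → stepOK x t ≡ true → any (_≡ᵇ e) t ≡ false → lastIs _ (x ∷ t) ≡ true → all (suc e ≤ᵇ_) t ≡ true
  rest [] _ _ _ = refl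
  rest (x′ ∷ t) steps e∉ last = above-after-last x′ t (∧-conicalʳ (x′ ≤ᵇ suc x) _ steps) e∉ last e<y

endingIn-suc-occurs : ∀ e w → avoidsEndingIn (suc e) w ≡ true → any (_≡ᵇ e) w ≡ true
endingIn-suc-occurs e (x ∷ t) Ew with ≡ᵇ-sound {x} {0} (∧-conicalˡ _ (stepOK x t) catalan)
  where catalan = avoidsEndingIn⇒isCatalan (suc e) (x ∷ t) Ew
endingIn-suc-occurs zero (.0 ∷ t) Ew | refl = refl
endingIn-suc-occurs (suc e) (.0 ∷ t) Ew | refl =
  occurs-between 0 t (∧-conicalʳ true _ (avoidsEndingIn⇒isCatalan _ (0 ∷ t) Ew)) z<s
                 (avoidsEndingIn⇒lastIs _ (0 ∷ t) Ew) (n<1+n (suc e))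

splitAtLast : ∀ e w → any (_≡ᵇ e) w ≡ true →
              ∃[ u ] ∃[ v ] w ≡ u ++ v × lastIs e u ≡ true × any (_≡ᵇ e) v ≡ false
splitAtLast e (x ∷ w) e∈ with any (_≡ᵇ e) w in e∈w
... | true with splitAtLast e w e∈w
...   | y ∷ u , v , refl , last , e∉v = x ∷ y ∷ u , v , refl , last , e∉v
splitAtLast e (x ∷ w) e∈ | false = x ∷ [] , w , refl , trans (sym (∨-identityʳ (x ≡ᵇ e))) e∈ , e∈w

lastIs-all-above : ∀ e t → lastIs e t ≡ true → all (suc e ≤ᵇ_) t ≡ true → ⊥
lastIs-all-above e (x ∷ []) last above =
  <-irrefl (sym (≡ᵇ-sound {x} last)) (≤ᵇ-sound {suc e} {x} (∧-conicalˡ _ true above))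
lastIs-all-above e (x ∷ y ∷ t) last above = lastIs-all-above e (y ∷ t) last (∧-conicalʳ (suc e ≤ᵇ x) _ above)

split-unique : ∀ e u v u′ v′ → u ++ v ≡ u′ ++ v′ → lastIs e u ≡ true → lastIs e u′ ≡ true →
               all (suc e ≤ᵇ_) v ≡ true → all (suc e ≤ᵇ_) v′ ≡ true → length u ≡ length u′
split-unique e (x ∷ []) v (x′ ∷ []) v′ eq last last′ above above′ = refl
split-unique e (x ∷ []) v (x′ ∷ y′ ∷ u′) v′ eq last last′ above above′ =
  ⊥-elim (ends-in-e-above (y′ ∷ u′) v′ last′ (subst (λ w → all (suc e ≤ᵇ_) w ≡ true) (∷-injectiveʳ eq) above))
  where
  ends-in-e-above : ∀ u v → lastIs e u ≡ true → all (suc e ≤ᵇ_) (u ++ v) ≡ true → ⊥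
  ends-in-e-above u v last above = lastIs-all-above e u last (∧-conicalˡ _ _ (trans (sym (all-++ _ u v)) above))
split-unique e (x ∷ y ∷ u) v (x′ ∷ []) v′ eq last last′ above above′ =
  sym (split-unique e (x′ ∷ []) v′ (x ∷ y ∷ u) v (sym eq) last′ last above′ above)
split-unique e (x ∷ y ∷ u) v (x′ ∷ y′ ∷ u′) v′ eq last last′ above above′ =
  cong suc (split-unique e (y ∷ u) v (y′ ∷ u′) v′ (∷-injectiveʳ eq) last last′ above above′)

endingIn-suc-join : ∀ e u v → avoidsEndingIn e u ≡ true → raisedZeroEnding (suc e) v ≡ true →
                    avoidsEndingIn (suc e) (u ++ v) ≡ true
endingIn-suc-join e (x ∷ u) (z ∷ v) Eu Dv =
  subst (λ v′ → avoidsEndingIn (suc e) (x ∷ u ++ v′) ≡ true) (raise-lower (suc e) (z ∷ v) above)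
        (trans (avoidsEndingIn-++-raise e x u (z ∸ suc e) (lower (suc e) v) (≡ᵇ-sound last))
               (cong₂ _∧_ (∧-conicalˡ (avoids (x ∷ u)) _ Eu) (∧-conicalʳ (all (suc e ≤ᵇ_) (z ∷ v)) _ Dv)))
  where
  above : all (suc e ≤ᵇ_) (z ∷ v) ≡ true
  above = ∧-conicalˡ _ (avoidsEndingIn 0 (lower (suc e) (z ∷ v))) Dv
  last : lastIs e (x ∷ u) ≡ true
  last = ∧-conicalʳ (avoids (x ∷ u)) _ Eu

endingIn-suc-split : ∀ e w → avoidsEndingIn (suc e) w ≡ true →
                     ∃[ u ] ∃[ v ] w ≡ u ++ v × avoidsEndingIn e u ≡ true × raisedZeroEnding (suc e) v ≡ true
endingIn-suc-split e w Ew with splitAtLast e w (endingIn-suc-occurs e w Ew)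
... | x ∷ u , [] , refl , last , _ =
  contradiction (trans (sym (≡ᵇ-sound {lastOr x u} ends-in-suc-e)) (≡ᵇ-sound {lastOr x u} last)) 1+n≢n
  where
  ends-in-suc-e : lastIs (suc e) (x ∷ u) ≡ true
  ends-in-suc-e = subst (λ w → lastIs (suc e) w ≡ true) (++-identityʳ (x ∷ u))
                        (avoidsEndingIn⇒lastIs _ (x ∷ u ++ []) Ew)
... | x ∷ u , z ∷ v , refl , last , e∉v =
  x ∷ u , z ∷ v , refl , cong₂ _∧_ (∧-conicalˡ (avoids (x ∷ u)) _ both) last
                       , cong₂ _∧_ above (∧-conicalʳ (avoids (x ∷ u)) _ both)
  where
  lastOr≡e : lastOr x u ≡ e
  lastOr≡e = ≡ᵇ-sound last
  steps : stepOK e (z ∷ v) ≡ true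
  steps = subst (λ p → stepOK p (z ∷ v) ≡ true) lastOr≡e (∧-conicalʳ (isCatalan (x ∷ u)) _
            (trans (sym (isCatalan-++ x u (z ∷ v))) (avoidsEndingIn⇒isCatalan _ (x ∷ u ++ z ∷ v) Ew)))
  above : all (suc e ≤ᵇ_) (z ∷ v) ≡ true
  above = above-after-last z v (∧-conicalʳ (z ≤ᵇ suc e) _ steps) e∉v
            (trans (sym (lastIs-++ (suc e) (x ∷ u) z v)) (avoidsEndingIn⇒lastIs _ (x ∷ u ++ z ∷ v) Ew))
            (n<1+n e)
  both : avoids (x ∷ u) ∧ avoidsEndingIn 0 (lower (suc e) (z ∷ v)) ≡ true
  both = trans (sym (avoidsEndingIn-++-raise e x u (z ∸ suc e) (lower (suc e) v) lastOr≡e))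
               (subst (λ v′ → avoidsEndingIn (suc e) (x ∷ u ++ v′) ≡ true)
                      (sym (raise-lower (suc e) (z ∷ v) above)) Ew)

endingIn-factorisation : ∀ e → Factorisation (avoidsEndingIn (suc e)) (avoidsEndingIn e) (raisedZeroEnding (suc e))
endingIn-factorisation e = record
  { split = endingIn-suc-split e
  ; join = endingIn-suc-join e
  ; unique = λ u v u′ v′ eq Eu Dv Eu′ Dv′ →
      split-unique e u v u′ v′ eq (avoidsEndingIn⇒lastIs e u Eu) (avoidsEndingIn⇒lastIs e u′ Eu′)
                   (∧-conicalˡ _ _ Dv) (∧-conicalˡ _ _ Dv′)
  }

-- Splitting off the last letter

hasGeGe-∷ʳ-0 : ∀ t → hasGeGe (t ++ [ 0 ]) ≡ hasGeGe t ∨ endsGe t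
hasGeGe-∷ʳ-0 [] = refl
hasGeGe-∷ʳ-0 (a ∷ []) = refl
hasGeGe-∷ʳ-0 (a ∷ b ∷ []) with b ≤ᵇ a
... | true = refl
... | false = refl
hasGeGe-∷ʳ-0 (a ∷ b ∷ c ∷ t) =
  trans (cong (((b ≤ᵇ a) ∧ (c ≤ᵇ b)) ∨_) (hasGeGe-∷ʳ-0 (b ∷ c ∷ t)))
        (sym (∨-assoc ((b ≤ᵇ a) ∧ (c ≤ᵇ b)) (hasGeGe (b ∷ c ∷ t)) (endsGe (b ∷ c ∷ t))))

avoids-∷ʳ-0 : ∀ x t → avoids (x ∷ t ++ [ 0 ]) ≡ inB⁺ (x ∷ t)
avoids-∷ʳ-0 x t = trans
  (cong₂ (λ s h → ((x ≡ᵇ 0) ∧ s) ∧ not h) (trans (stepOK-++ x t [ 0 ]) (∧-identityʳ _)) (hasGeGe-∷ʳ-0 (x ∷ t)))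
  (not-∨ (isCatalan (x ∷ t)) (hasGeGe (x ∷ t)) (endsGe (x ∷ t)))
  where
  not-∨ : ∀ a b c → a ∧ not (b ∨ c) ≡ (a ∧ not b) ∧ not c
  not-∨ true true c = refl
  not-∨ true false c = refl
  not-∨ false b c = refl

emptyOrRaisedB-as-avoids : ∀ c u → all (c ≤ᵇ_) u ∧ avoids (lower c u ++ [ 0 ]) ≡ emptyOrRaisedB c u
emptyOrRaisedB-as-avoids c [] = refl
emptyOrRaisedB-as-avoids c (x ∷ u) = cong (all (c ≤ᵇ_) (x ∷ u) ∧_) (avoids-∷ʳ-0 (x ∸ c) (lower c u))

raisedZeroEnding-∷ʳ : ∀ c u y → raisedZeroEnding c (u ++ [ y ]) ≡ emptyOrRaisedB c u ∧ (y ≡ᵇ c)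
raisedZeroEnding-∷ʳ c u y = begin
  all (c ≤ᵇ_) (u ++ [ y ]) ∧ (avoids (lower c (u ++ [ y ])) ∧ lastIs 0 (lower c (u ++ [ y ])))
    ≡⟨ cong₂ (λ a l → a ∧ (avoids l ∧ lastIs 0 l)) (all-++ (c ≤ᵇ_) u [ y ]) (map-++ (_∸ c) u [ y ]) ⟩
  (A ∧ ((c ≤ᵇ y) ∧ true)) ∧ (avoids t ∧ lastIs 0 t)
    ≡⟨ cong (λ l → (A ∧ ((c ≤ᵇ y) ∧ true)) ∧ (avoids t ∧ l)) (lastIs-++ 0 (lower c u) (y ∸ c) []) ⟩
  (A ∧ ((c ≤ᵇ y) ∧ true)) ∧ (avoids t ∧ (y ∸ c ≡ᵇ 0))
    ≡⟨ rearrange A (c ≤ᵇ y) (avoids t) (y ∸ c ≡ᵇ 0) ⟩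
  (A ∧ avoids t) ∧ ((c ≤ᵇ y) ∧ (y ∸ c ≡ᵇ 0))
    ≡⟨ cong ((A ∧ avoids t) ∧_) (≤ᵇ-∧-∸≡ᵇ0 c y) ⟩
  (A ∧ avoids t) ∧ (y ≡ᵇ c)
    ≡⟨ last-letter-c ⟩
  emptyOrRaisedB c u ∧ (y ≡ᵇ c) ∎
  where
  open ≡-Reasoning
  A = all (c ≤ᵇ_) u
  t = lower c u ++ [ y ∸ c ]
  rearrange : ∀ a b d f → (a ∧ (b ∧ true)) ∧ (d ∧ f) ≡ (a ∧ d) ∧ (b ∧ f)
  rearrange true true d f = refl
  rearrange true false d f = sym (∧-zeroʳ d)
  rearrange false b d f = refl
  last-letter-c : (A ∧ avoids t) ∧ (y ≡ᵇ c) ≡ emptyOrRaisedB c u ∧ (y ≡ᵇ c)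
  last-letter-c with y ≟ c
  ... | yes refl = trans (cong (λ z → (A ∧ avoids (lower c u ++ [ z ])) ∧ (c ≡ᵇ c)) (n∸n≡0 c))
                         (cong (_∧ (c ≡ᵇ c)) (emptyOrRaisedB-as-avoids c u))
  ... | no y≢c rewrite ≡ᵇ-false y≢c = trans (∧-zeroʳ _) (sym (∧-zeroʳ _))

raisedZeroEnding-factorisation : ∀ c → Factorisation (raisedZeroEnding c) (emptyOrRaisedB c) (isLetter c)
raisedZeroEnding-factorisation c = record { split = split ; join = join ; unique = unique }
  where
  split : ∀ w → raisedZeroEnding c w ≡ true →
          ∃[ u ] ∃[ v ] w ≡ u ++ v × emptyOrRaisedB c u ≡ true × isLetter c v ≡ true
  split w Dw with initLast w
  split .(u ++ [ y ]) Dw | u ∷ʳ′ y =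
    u , [ y ] , refl , ∧-conicalˡ _ _ factors , ∧-conicalʳ (emptyOrRaisedB c u) _ factors
    where
    factors : emptyOrRaisedB c u ∧ (y ≡ᵇ c) ≡ true
    factors = trans (sym (raisedZeroEnding-∷ʳ c u y)) Dw

  join : ∀ u v → emptyOrRaisedB c u ≡ true → isLetter c v ≡ true → raisedZeroEnding c (u ++ v) ≡ true
  join u (y ∷ []) Pu y≡c = trans (raisedZeroEnding-∷ʳ c u y) (cong₂ _∧_ Pu y≡c)

  unique : ∀ u v u′ v′ → u ++ v ≡ u′ ++ v′ → emptyOrRaisedB c u ≡ true → isLetter c v ≡ true →
           emptyOrRaisedB c u′ ≡ true → isLetter c v′ ≡ true → length u ≡ length u′
  unique u (y ∷ []) u′ (y′ ∷ []) eq _ _ _ _ =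
    +-cancelʳ-≡ 1 (length u) (length u′) (trans (sym (length-++ u)) (trans (cong length eq) (length-++ u′)))

stepOK-bounded : ∀ {L} p t → stepOK p t ≡ true → suc p + length t ≤ L → All (_< L) t
stepOK-bounded p [] _ _ = []
stepOK-bounded {L} p (x ∷ t) steps bound = x<L ∷ stepOK-bounded x t (∧-conicalʳ (x ≤ᵇ suc p) _ steps) rest-bound
  where
  x≤1+p : x ≤ suc p
  x≤1+p = ≤ᵇ-sound {x} (∧-conicalˡ _ (stepOK x t) steps)
  bound′ : suc (suc p) + length t ≤ L
  bound′ = ≤-trans (≤-reflexive (sym (+-suc (suc p) (length t)))) bound
  rest-bound : suc x + length t ≤ L
  rest-bound = ≤-trans (+-monoˡ-≤ (length t) (s≤s x≤1+p)) bound′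
  x<L : x < L
  x<L = ≤-trans (s≤s x≤1+p) (≤-trans (m≤m+n (suc (suc p)) (length t)) bound′)

catalan-bounded : ∀ w → isCatalan w ≡ true → All (_< length w) w
catalan-bounded [] _ = []
catalan-bounded (x ∷ t) catalan with ≡ᵇ-sound {x} {0} (∧-conicalˡ _ (stepOK x t) catalan)
... | refl = z<s ∷ stepOK-bounded 0 t (∧-conicalʳ true _ catalan) ≤-refl

avoidsEndingIn-bounded : ∀ e → Bounded (λ n → n) (avoidsEndingIn e)
avoidsEndingIn-bounded e w Ew = catalan-bounded w (avoidsEndingIn⇒isCatalan e w Ew)

raisedZeroEnding-bounded : ∀ c → Bounded (c +_) (raisedZeroEnding c)
raisedZeroEnding-bounded c v Dv = subst (All (_< c + length v)) (raise-lower c v (∧-conicalˡ _ _ Dv))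
  (gmap⁺ (+-monoʳ-< c) (subst (λ l → All (_< l) (lower c v)) (length-map (_∸ c) v)
    (catalan-bounded (lower c v)
      (avoidsEndingIn⇒isCatalan 0 (lower c v) (∧-conicalʳ (all (c ≤ᵇ_) v) _ Dv)))))

inB⁺-bounded : Bounded (λ n → n) inB⁺
inB⁺-bounded (x ∷ w) Bw = catalan-bounded (x ∷ w) (∧-conicalˡ _ _ (∧-conicalˡ _ _ Bw))

All-lastOr : ∀ {P : ℕ → Set} x w → All P (x ∷ w) → P (lastOr x w)
All-lastOr x [] (px ∷ []) = px
All-lastOr x (y ∷ w) (_ ∷ pw) = All-lastOr y w pw

genFun-inB⁺ : ∀ {n} a k → a ≤ n → genFun inB⁺ n a k ≡ Bser a k
genFun-inB⁺ a k a≤n = trans (genFun-alphabet inB⁺-bounded a k a≤n) (exact a)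
  where
  open ≡-Reasoning
  counted : Word → ℕ
  counted w = ⟦ isCatalan w ∧ (not (hasGeGe w) ∧ (not (endsGe w) ∧ (area w ≡ᵇ k))) ⟧
  ⟦inB⁺⟧ : ∀ w → counted w ≡ ⟦ (isCatalan w ∧ not (hasGeGe w)) ∧ not (endsGe w) ⟧ * ⟦ area w ≡ᵇ k ⟧
  ⟦inB⁺⟧ w = trans (cong ⟦_⟧ (sym (trans (∧-assoc (c ∧ nh) ne A) (∧-assoc c nh (ne ∧ A))))) (⟦∧⟧ ((c ∧ nh) ∧ ne) A)
    where
    c = isCatalan w
    nh = not (hasGeGe w)
    ne = not (endsGe w)
    A = area w ≡ᵇ k
  exact : ∀ a → genFun inB⁺ a a k ≡ Bser a k
  exact zero = refl
  exact (suc a) = begin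
    genFun inB⁺ (suc a) (suc a) k
      ≡⟨ sumWords-cong (suc a) (suc a) {counted} {λ w → ⟦ inB⁺ w ⟧ * ⟦ area w ≡ᵇ k ⟧}
                       (λ { (x ∷ w) _ → ⟦inB⁺⟧ (x ∷ w) }) ⟨
    sumWords (suc a) (suc a) counted
      ≡⟨ count-catalanWords (suc a) _ ⟨
    Bser (suc a) k ∎

genFun-null : ∀ m a k → genFun null m a k ≡ 𝟙 a k
genFun-null m zero zero = refl
genFun-null m zero (suc k) = refl
genFun-null m (suc a) k =
  sumWords-zero (suc a) m {λ u → ⟦ null u ⟧ * ⟦ area u ≡ᵇ k ⟧} (λ { (x ∷ w) _ → refl })

genFun-raisedB⁺ : ∀ c n a k → a ≤ n → genFun (raisedB⁺ c) (c + n) a k ≡ substXq c Bser a k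
genFun-raisedB⁺ c n a k a≤n = begin
  sumWords a (c + n) (λ u → ⟦ raisedB⁺ c u ⟧ * ⟦ area u ≡ᵇ k ⟧)
    ≡⟨ sumWords-cong a (c + n) (λ u _ → trans (cong (_* ⟦ area u ≡ᵇ k ⟧) (⟦∧⟧ (all (c ≤ᵇ_) u) _))
                                              (*-assoc ⟦ all (c ≤ᵇ_) u ⟧ _ _)) ⟩
  sumWords a (c + n) (λ u → ⟦ all (c ≤ᵇ_) u ⟧ * (⟦ inB⁺ (lower c u) ⟧ * ⟦ area u ≡ᵇ k ⟧))
    ≡⟨ sumWords-raise a c n _ ⟩
  sumWords a n (λ t → ⟦ inB⁺ (lower c (raise c t)) ⟧ * ⟦ area (raise c t) ≡ᵇ k ⟧)
    ≡⟨ sumWords-cong a n raised-pointwise ⟩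
  sumWords a n (λ t → shift₁ (c * a) (λ r → ⟦ inB⁺ t ⟧ * ⟦ area t ≡ᵇ r ⟧) k)
    ≡⟨ sumWords-shift₁ a n (c * a) (λ t r → ⟦ inB⁺ t ⟧ * ⟦ area t ≡ᵇ r ⟧) k ⟩
  shift₁ (c * a) (genFun inB⁺ n a) k
    ≡⟨ shift₁-cong (c * a) k (λ r → genFun-inB⁺ a r a≤n) ⟩
  substXq c Bser a k ∎
  where
  open ≡-Reasoning
  raised-pointwise : ∀ t → length t ≡ a → ⟦ inB⁺ (lower c (raise c t)) ⟧ * ⟦ area (raise c t) ≡ᵇ k ⟧
                                         ≡ shift₁ (c * a) (λ r → ⟦ inB⁺ t ⟧ * ⟦ area t ≡ᵇ r ⟧) k
  raised-pointwise t refl = begin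
    ⟦ inB⁺ (lower c (raise c t)) ⟧ * ⟦ area (raise c t) ≡ᵇ k ⟧
      ≡⟨ cong₂ (λ t′ A → ⟦ inB⁺ t′ ⟧ * ⟦ A ≡ᵇ k ⟧) (lower-raise c t) (area-raise c t) ⟩
    ⟦ inB⁺ t ⟧ * ⟦ c * length t + area t ≡ᵇ k ⟧
      ≡⟨ cong (⟦ inB⁺ t ⟧ *_) (⟦+≡ᵇ⟧ (c * length t) (area t) k) ⟩
    ⟦ inB⁺ t ⟧ * shift₁ (c * length t) (λ r → ⟦ area t ≡ᵇ r ⟧) k
      ≡⟨ shift₁-*ˡ (c * length t) ⟦ inB⁺ t ⟧ (λ r → ⟦ area t ≡ᵇ r ⟧) k ⟩
    shift₁ (c * length t) (λ r → ⟦ inB⁺ t ⟧ * ⟦ area t ≡ᵇ r ⟧) k ∎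

genFun-emptyOrRaisedB : ∀ c n a k → a ≤ n → genFun (emptyOrRaisedB c) (c + n) a k ≡ factor c a k
genFun-emptyOrRaisedB c n a k a≤n = begin
  sumWords a (c + n) (λ u → ⟦ emptyOrRaisedB c u ⟧ * ⟦ area u ≡ᵇ k ⟧)
    ≡⟨ sumWords-cong a (c + n) (λ u _ → trans (cong (_* ⟦ area u ≡ᵇ k ⟧) (⟦emptyOrRaisedB⟧ u))
                                              (*-distribʳ-+ ⟦ area u ≡ᵇ k ⟧ ⟦ null u ⟧ _)) ⟩
  sumWords a (c + n) (λ u → ⟦ null u ⟧ * ⟦ area u ≡ᵇ k ⟧ + ⟦ raisedB⁺ c u ⟧ * ⟦ area u ≡ᵇ k ⟧)
    ≡⟨ sumWords-distrib-+ a (c + n) _ _ ⟩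
  genFun null (c + n) a k + genFun (raisedB⁺ c) (c + n) a k
    ≡⟨ cong₂ _+_ (genFun-null (c + n) a k) (genFun-raisedB⁺ c n a k a≤n) ⟩
  𝟙 a k + substXq c Bser a k ∎
  where
  open ≡-Reasoning
  ⟦emptyOrRaisedB⟧ : ∀ u → ⟦ emptyOrRaisedB c u ⟧ ≡ ⟦ null u ⟧ + ⟦ raisedB⁺ c u ⟧
  ⟦emptyOrRaisedB⟧ [] = refl
  ⟦emptyOrRaisedB⟧ (_ ∷ _) = refl

genFun-isLetter : ∀ c n d k → d ≤ n → genFun (isLetter c) (c + n) d k ≡ mono 1 (suc c) d k
genFun-isLetter c n zero k _ = refl
genFun-isLetter c n (suc zero) k 1≤n = begin
  sumTo (c + n) (λ x → ⟦ x ≡ᵇ c ⟧ * ⟦ suc x + 0 ≡ᵇ k ⟧)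
    ≡⟨ sumTo-single (c + n) c _ (≤-trans (≤-reflexive (+-comm 1 c)) (+-monoʳ-≤ c 1≤n)) others ⟩
  ⟦ c ≡ᵇ c ⟧ * ⟦ suc c + 0 ≡ᵇ k ⟧
    ≡⟨ cong (λ b → ⟦ b ⟧ * ⟦ suc c + 0 ≡ᵇ k ⟧) (≡ᵇ-refl c) ⟩
  ⟦ suc c + 0 ≡ᵇ k ⟧ + 0
    ≡⟨ +-identityʳ _ ⟩
  ⟦ suc c + 0 ≡ᵇ k ⟧
    ≡⟨ cong ⟦_⟧ (trans (cong (_≡ᵇ k) (+-identityʳ (suc c))) (≡ᵇ-sym (suc c) k)) ⟩
  ⟦ k ≡ᵇ suc c ⟧
    ≡⟨ ⟦⟧-if (k ≡ᵇ suc c) ⟩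
  mono 1 (suc c) 1 k ∎
  where
  open ≡-Reasoning
  others : ∀ x → x < c + n → x ≢ c → ⟦ x ≡ᵇ c ⟧ * ⟦ suc x + 0 ≡ᵇ k ⟧ ≡ 0
  others x _ x≢c = cong (λ b → ⟦ b ⟧ * ⟦ suc x + 0 ≡ᵇ k ⟧) (≡ᵇ-false x≢c)
  ⟦⟧-if : ∀ b → ⟦ b ⟧ ≡ (if b then 1 else 0)
  ⟦⟧-if true = refl
  ⟦⟧-if false = refl
genFun-isLetter c n (suc (suc d)) k _ =
  sumWords-zero (suc (suc d)) (c + n) {λ w → ⟦ isLetter c w ⟧ * ⟦ area w ≡ᵇ k ⟧} (λ { (x ∷ y ∷ w) _ → refl })

genFun-raisedZeroEnding : ∀ c n k → genFun (raisedZeroEnding c) (c + n) n k ≡ (factor c ⊗ mono 1 (suc c)) n k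
genFun-raisedZeroEnding c n k = trans (genFun-⊗ (raisedZeroEnding-factorisation c) (c + n) n k)
  (⊗-coeff-cong n k (genFun-emptyOrRaisedB c n) (genFun-isLetter c n))

genFunEndingIn : ℕ → Series
genFunEndingIn e n = genFun (avoidsEndingIn e) n n

genFunEndingIn-zero : genFunEndingIn 0 ≈ factor 0 ⊗ mono 1 1
genFunEndingIn-zero n k =
  trans (sumWords-cong n n (λ w _ → cong (λ b → ⟦ b ⟧ * ⟦ area w ≡ᵇ k ⟧) (sym (raisedZeroEnding-0 w))))
        (genFun-raisedZeroEnding 0 n k)
  where
  raisedZeroEnding-0 : ∀ w → raisedZeroEnding 0 w ≡ avoidsEndingIn 0 w
  raisedZeroEnding-0 w = trans (cong (raisedZeroEnding 0) (sym (map-id w))) (raisedZeroEnding-raise 0 w)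

genFunEndingIn-suc : ∀ e → genFunEndingIn (suc e) ≈ genFunEndingIn e ⊗ (factor (suc e) ⊗ mono 1 (suc (suc e)))
genFunEndingIn-suc e n k = begin
  genFun (avoidsEndingIn (suc e)) n n k
    ≡⟨ genFun-alphabet (avoidsEndingIn-bounded (suc e)) n k (m≤n+m n (suc e)) ⟨
  genFun (avoidsEndingIn (suc e)) M n k
    ≡⟨ genFun-⊗ (endingIn-factorisation e) M n k ⟩
  (genFun (avoidsEndingIn e) M ⊗ genFun (raisedZeroEnding (suc e)) M) n k
    ≡⟨ ⊗-coeff-cong n k
         (λ a b a≤n → genFun-alphabet (avoidsEndingIn-bounded e) a b (≤-trans a≤n (m≤n+m n (suc e))))
         (λ d b d≤n → trans (genFun-alphabet (raisedZeroEnding-bounded (suc e)) d b (+-monoʳ-≤ (suc e) d≤n))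
                            (genFun-raisedZeroEnding (suc e) d b)) ⟩
  (genFunEndingIn e ⊗ (factor (suc e) ⊗ mono 1 (suc (suc e)))) n k ∎
  where
  open ≡-Reasoning
  M = suc e + n

genFunEndingIn≈summand : ∀ e → genFunEndingIn e ≈ summand (suc e)
genFunEndingIn≈summand zero = begin
  genFunEndingIn 0    ≈⟨ genFunEndingIn-zero ⟩
  X                   ≈⟨ 𝟙-⊗ X ⟨
  𝟙 ⊗ X               ≈⟨ ⊗-congˡ X summand-zero ⟨
  summand 0 ⊗ X       ≈⟨ summand-suc 0 ⟨
  summand 1           ∎
  where
  open SetoidReasoning ≈-setoid
  X = factor 0 ⊗ mono 1 1
genFunEndingIn≈summand (suc e) = begin
  genFunEndingIn (suc e)   ≈⟨ genFunEndingIn-suc e ⟩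
  genFunEndingIn e ⊗ X     ≈⟨ ⊗-congˡ X (genFunEndingIn≈summand e) ⟩
  summand (suc e) ⊗ X      ≈⟨ summand-suc (suc e) ⟨
  summand (suc (suc e))    ∎
  where
  open SetoidReasoning ≈-setoid
  X = factor (suc e) ⊗ mono 1 (suc (suc e))

⟦avoids⟧-by-last-letter : ∀ x w → ⟦ avoids (x ∷ w) ⟧ ≡ sumTo (suc (length w)) (λ e → ⟦ avoidsEndingIn e (x ∷ w) ⟧)
⟦avoids⟧-by-last-letter x w with avoids (x ∷ w) in av
... | false = sym (sumTo-zero (suc (length w)) (λ _ _ → refl))
... | true = sym (trans (sumTo-single (suc (length w)) (lastOr x w) _ last<1+∣w∣ others)
                        (cong ⟦_⟧ (≡ᵇ-refl (lastOr x w))))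
  where
  last<1+∣w∣ : lastOr x w < suc (length w)
  last<1+∣w∣ = All-lastOr x w (catalan-bounded (x ∷ w) (∧-conicalˡ (isCatalan (x ∷ w)) _ av))
  others : ∀ e → e < suc (length w) → e ≢ lastOr x w → ⟦ true ∧ lastIs e (x ∷ w) ⟧ ≡ 0
  others e _ e≢last = cong ⟦_⟧ (≡ᵇ-false (e≢last ∘ sym))

Cge-by-last-letter : ∀ n k → Cge n k ≡ sumTo n (λ e → genFunEndingIn e n k)
Cge-by-last-letter zero k = refl
Cge-by-last-letter (suc n) k = begin
  Cge (suc n) k
    ≡⟨ count-catalanWords (suc n) _ ⟩
  sumWords (suc n) (suc n) counted
    ≡⟨ sumWords-cong (suc n) (suc n) {counted} {by-last-letter}
                     (λ { (x ∷ w) ∣w∣≡n → pointwise x w (suc-injective ∣w∣≡n) }) ⟩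
  sumWords (suc n) (suc n) by-last-letter
    ≡⟨ sumWords-sumTo (suc n) (suc n) (suc n) (λ e w → ⟦ avoidsEndingIn e w ⟧ * ⟦ area w ≡ᵇ k ⟧) ⟩
  sumTo (suc n) (λ e → genFunEndingIn e (suc n) k) ∎
  where
  open ≡-Reasoning
  counted by-last-letter : Word → ℕ
  counted w = ⟦ isCatalan w ∧ (not (hasGeGe w) ∧ (area w ≡ᵇ k)) ⟧
  by-last-letter w = sumTo (suc n) (λ e → ⟦ avoidsEndingIn e w ⟧ * ⟦ area w ≡ᵇ k ⟧)
  pointwise : ∀ x w → length w ≡ n → counted (x ∷ w) ≡ by-last-letter (x ∷ w)
  pointwise x w refl = begin
    ⟦ isCatalan (x ∷ w) ∧ (not (hasGeGe (x ∷ w)) ∧ A) ⟧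
      ≡⟨ cong ⟦_⟧ (∧-assoc (isCatalan (x ∷ w)) _ A) ⟨
    ⟦ avoids (x ∷ w) ∧ A ⟧
      ≡⟨ ⟦∧⟧ (avoids (x ∷ w)) A ⟩
    ⟦ avoids (x ∷ w) ⟧ * ⟦ A ⟧
      ≡⟨ cong (_* ⟦ A ⟧) (⟦avoids⟧-by-last-letter x w) ⟩
    sumTo (suc (length w)) (λ e → ⟦ avoidsEndingIn e (x ∷ w) ⟧) * ⟦ A ⟧
      ≡⟨ sumTo-*ʳ (suc (length w)) ⟦ A ⟧ _ ⟨
    sumTo (suc (length w)) (λ e → ⟦ avoidsEndingIn e (x ∷ w) ⟧ * ⟦ A ⟧) ∎
    where A = area (x ∷ w) ≡ᵇ k

theorem4p2 : ∀ (n k : ℕ) → ∃[ N ] (∀ (M : ℕ) → N ≤ M → Cge n k ≡ partialSum M n k)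
theorem4p2 n k = n , λ M n≤M → begin
  Cge n k                               ≡⟨ Cge-by-last-letter n k ⟩
  sumTo n (λ e → genFunEndingIn e n k)        ≡⟨ sumTo-cong n (λ e _ → genFunEndingIn≈summand e n k) ⟩
  sumTo n (λ e → summand (suc e) n k)   ≡⟨ sumTo-truncate n _ n≤M (λ e n≤e → summand-vanishes (suc e) k (s≤s n≤e)) ⟨
  partialSum M n k                      ∎
  where open ≡-Reasoning
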